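{- Let $M$ be a countable model of ${\rm PA}$, or more generally of $\mathrm{I}\Delta_0+\mathrm{Exp}$, and let $\mathbb{Z}^M$ be the ring of integers constructed from $M$ (the ordered ring whose non-negative part is $M$). Then $\langle\mathbb{Z}^M,+,\cdot\rangle$ admits a continuous presentation on the rational line $\mathbb{Q}$: there are binary operations $\oplus,\otimes$ on $\mathbb{Q}$, continuous with respect to the usual topology of $\mathbb{Q}$, with $\langle\mathbb{Q},\oplus,\otimes\rangle\cong\langle\mathbb{Z}^M,+,\cdot\rangle$.
   Context: $\mathrm{I}\Delta_0+\mathrm{Exp}$ is the theory of the non-negative part of a discretely ordered ring with induction for bounded-quantifier formulas and the axiom asserting totality of $x\mapsto 2^x$. -}

module Defs where

open import Level using (0ℓ)
open import Data.Nat using (ℕ)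
open import Data.Fin using (Fin)
open import Data.Vec.Functional using (_∷_)
open import Data.Product using (Σ; ∃; _×_; _,_)
open import Data.Sum using (_⊎_)
open import Data.Empty using (⊥)
open import Relation.Nullary using (¬_)
open import Relation.Binary.PropositionalEquality using (_≡_)
import Data.Rational as Q

-- First-order language of arithmetic with exponentiation:
-- symbols 0, 1, +, ·, exp (x ↦ 2^x), =, <.
-- Variables are de Bruijn indices in Fin n.

data Term (n : ℕ) : Set where
  var  : Fin n → Term n
  `0   : Term n
  `1   : Term n
  _`+_ : Term n → Term n → Term n
  _`*_ : Term n → Term n → Term n
  `exp : Term n → Term n

-- Bounded (Δ₀) formulas: all quantifiers are bounded, ∀ x < t / ∃ x < t,
-- where t is a term not containing the bound variable x
-- (x is the new variable 'Fin.zero' in the body).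
data Δ₀ (n : ℕ) : Set where
  _`≡_   : Term n → Term n → Δ₀ n
  _`<_   : Term n → Term n → Δ₀ n
  `⊥     : Δ₀ n
  `¬_    : Δ₀ n → Δ₀ n
  _`∧_   : Δ₀ n → Δ₀ n → Δ₀ n
  _`∨_   : Δ₀ n → Δ₀ n → Δ₀ n
  _`⇒_   : Δ₀ n → Δ₀ n → Δ₀ n
  `∀<    : Term n → Δ₀ (ℕ.suc n) → Δ₀ n
  `∃<    : Term n → Δ₀ (ℕ.suc n) → Δ₀ n

record Structure : Set₁ where
  field
    Carrier : Set
    zero one : Carrier
    _+_ _*_ : Carrier → Carrier → Carrier
    exp : Carrier → Carrier
    _<_ : Carrier → Carrier → Set

  evalT : ∀ {n} → (Fin n → Carrier) → Term n → Carrier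
  evalT ρ (var i) = ρ i
  evalT ρ `0 = zero
  evalT ρ `1 = one
  evalT ρ (s `+ t) = evalT ρ s + evalT ρ t
  evalT ρ (s `* t) = evalT ρ s * evalT ρ t
  evalT ρ (`exp t) = exp (evalT ρ t)

  -- Tarski satisfaction (read classically; see the ExcludedMiddle
  -- hypothesis of the main theorem)
  sat : ∀ {n} → (Fin n → Carrier) → Δ₀ n → Set
  sat ρ (s `≡ t) = evalT ρ s ≡ evalT ρ t
  sat ρ (s `< t) = evalT ρ s < evalT ρ t
  sat ρ `⊥ = ⊥
  sat ρ (`¬ φ) = ¬ sat ρ φ
  sat ρ (φ `∧ ψ) = sat ρ φ × sat ρ ψ
  sat ρ (φ `∨ ψ) = sat ρ φ ⊎ sat ρ ψ
  sat ρ (φ `⇒ ψ) = sat ρ φ → sat ρ ψ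
  sat ρ (`∀< t φ) = ∀ x → x < evalT ρ t → sat (x ∷ ρ) φ
  sat ρ (`∃< t φ) = Σ Carrier λ x → x < evalT ρ t × sat (x ∷ ρ) φ

  _≤_ : Carrier → Carrier → Set
  x ≤ y = x < y ⊎ x ≡ y

  -- PA⁻ : axioms of the non-negative part of a discretely ordered ring
  -- (Kaye, "Models of Peano Arithmetic", §2.1)
  record IsPAminus : Set where
    field
      +-comm  : ∀ x y → x + y ≡ y + x
      +-assoc : ∀ x y z → (x + y) + z ≡ x + (y + z)
      *-comm  : ∀ x y → x * y ≡ y * x
      *-assoc : ∀ x y z → (x * y) * z ≡ x * (y * z)
      distrib : ∀ x y z → x * (y + z) ≡ (x * y) + (x * z)
      +-identity : ∀ x → x + zero ≡ x
      *-zero  : ∀ x → x * zero ≡ zero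
      *-identity : ∀ x → x * one ≡ x
      <-trans : ∀ x y z → x < y → y < z → x < z
      <-irrefl : ∀ x → ¬ (x < x)
      <-trichotomy : ∀ x y → x < y ⊎ x ≡ y ⊎ y < x
      +-mono-< : ∀ x y z → x < y → (x + z) < (y + z)
      *-mono-< : ∀ x y z → zero < z → x < y → (x * z) < (y * z)
      <⇒∃+ : ∀ x y → x < y → Σ Carrier λ z → x + z ≡ y
      0<1 : zero < one
      discrete : ∀ x → zero < x → one ≤ x
      nonneg : ∀ x → zero ≤ x

  record IsExp : Set where
    field
      exp-zero : exp zero ≡ one
      exp-suc  : ∀ x → exp (x + one) ≡ exp x + exp x

  IΔ₀-induction : Set
  IΔ₀-induction = ∀ {n} (φ : Δ₀ (ℕ.suc n)) (ρ : Fin n → Carrier) →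
    sat (zero ∷ ρ) φ →
    (∀ x → sat (x ∷ ρ) φ → sat ((x + one) ∷ ρ) φ) →
    ∀ x → sat (x ∷ ρ) φ

-- A model of IΔ₀ + Exp, presented as a model of IΔ₀(exp)
-- (exp a symbol with its recursion equations).
record IsModelIΔ₀Exp (M : Structure) : Set where
  open Structure M
  field
    paMinus : IsPAminus
    expAx   : IsExp
    ind     : IΔ₀-induction

Countable : Set → Set
Countable A = Σ (ℕ → A) λ f → ∀ a → ∃ λ n → f n ≡ a

-- The ring of integers ℤ^M built from M: pairs (a , b) standing for
-- a − b, with (a , b) ≈ (c , d) iff a + d = c + b.

module IntegersOf (M : Structure) where
  open Structure M

  ℤᴹ : Set
  ℤᴹ = Carrier × Carrier

  _≈ᶻ_ : ℤᴹ → ℤᴹ → Set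
  (a , b) ≈ᶻ (c , d) = a + d ≡ c + b

  _+ᶻ_ : ℤᴹ → ℤᴹ → ℤᴹ
  (a , b) +ᶻ (c , d) = (a + c , b + d)

  _*ᶻ_ : ℤᴹ → ℤᴹ → ℤᴹ
  (a , b) *ᶻ (c , d) = ((a * c) + (b * d) , (a * d) + (b * c))

  record IsoTo (_⊕_ _⊗_ : Q.ℚ → Q.ℚ → Q.ℚ) : Set where
    field
      f : Q.ℚ → ℤᴹ
      injective : ∀ p q → f p ≈ᶻ f q → p ≡ q
      surjective : ∀ z → Σ Q.ℚ λ p → f p ≈ᶻ z
      hom-+ : ∀ p q → f (p ⊕ q) ≈ᶻ (f p +ᶻ f q)
      hom-* : ∀ p q → f (p ⊗ q) ≈ᶻ (f p *ᶻ f q)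

Continuous₂ : (Q.ℚ → Q.ℚ → Q.ℚ) → Set
Continuous₂ _∙_ = ∀ x y ε → Q.0ℚ Q.< ε →
  Σ Q.ℚ λ δ → Q.0ℚ Q.< δ ×
    (∀ x′ y′ → Q.∣ x Q.- x′ ∣ Q.< δ → Q.∣ y Q.- y′ ∣ Q.< δ →
       Q.∣ (x ∙ y) Q.- (x′ ∙ y′) ∣ Q.< ε)

module Submission where

open import Defs
open import Level using (0ℓ)
open import Axiom.ExcludedMiddle using (ExcludedMiddle)
open import Data.Product using (Σ; _×_)
open import Data.Rational using (ℚ)
open import Data.Product using (_,_)

-- Equip ℤᴹ with the topology of congruences modulo a chain n₀ ∣ n₁ ∣ … of
-- moduli eventually exceeding every element of M.  Like ℚ, it is then a
-- countable metrisable space without isolated points, so by Sierpiński's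
-- theorem there is a homeomorphism ψ : ℚ → ℤᴹ.  Transporting + and · along ψ
-- gives the operations on ℚ; they are continuous because + and · respect every
-- congruence.  ψ matches points by their addresses in trees of clopen sets; on
-- ℚ these are cut out by the irrational numbers ∛(2 (2j + 1) / 8ⁱ).

module Countability where
  open import Data.Nat using (ℕ; zero; suc; _+_)
  open import Data.Nat.Properties using (+-suc; +-identityʳ)
  open import Data.Product using (∃; proj₁; proj₂)
  open import Relation.Binary.PropositionalEquality using (_≡_; refl; sym; trans; cong; cong₂; subst)

  countable-ℕ : Countable ℕ
  countable-ℕ = (λ n → n) , λ n → n , refl

  countable-surjection : ∀ {A B : Set} → Countable A → (f : A → B) →
                         (∀ b → ∃ λ a → f a ≡ b) → Countable B
  countable-surjection (e , e-onto) f f-onto = (λ n → f (e n)) , λ b →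
    let a , fa≡b = f-onto b; n , en≡a = e-onto a in n , trans (cong f en≡a) fa≡b

  -- Walks the diagonals (0 , s), (1 , s ∸ 1), …, (s , 0), then (0 , s + 1).
  diagonal-next : ℕ × ℕ → ℕ × ℕ
  diagonal-next (a , zero) = 0 , suc a
  diagonal-next (a , suc b) = suc a , b

  unpair : ℕ → ℕ × ℕ
  unpair zero = 0 , 0
  unpair (suc n) = diagonal-next (unpair n)

  unpair-surjective : ∀ a b → ∃ λ n → unpair n ≡ (a , b)
  unpair-surjective a b = along-diagonal a b (diagonal-start (a + b))
    where
      Reached : ℕ × ℕ → Set
      Reached p = ∃ λ n → unpair n ≡ p

      step : ∀ {p} → Reached p → Reached (diagonal-next p)
      step (n , eq) = suc n , cong diagonal-next eq

      along-diagonal : ∀ a b → Reached (0 , a + b) → Reached (a , b)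
      along-diagonal zero b r = r
      along-diagonal (suc a) b r =
        step (along-diagonal a (suc b) (subst (λ s → Reached (0 , s)) (sym (+-suc a b)) r))

      diagonal-start : ∀ s → Reached (0 , s)
      diagonal-start zero = 0 , refl
      diagonal-start (suc s) =
        step (along-diagonal s 0 (subst (λ s → Reached (0 , s)) (sym (+-identityʳ s)) (diagonal-start s)))

  countable-× : ∀ {A B : Set} → Countable A → Countable B → Countable (A × B)
  countable-× (e , e-onto) (e′ , e′-onto) = (λ n → let a , b = unpair n in e a , e′ b) , λ (x , y) →
    let a , ea≡x = e-onto x; b , e′b≡y = e′-onto y; n , eq = unpair-surjective a b
    in n , subst (λ p → (e (proj₁ p) , e′ (proj₂ p)) ≡ (x , y)) (sym eq) (cong₂ _,_ ea≡x e′b≡y)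

module Classical (em : ExcludedMiddle 0ℓ) where
  open import Data.Nat using (ℕ; zero; suc; _≤_; _<_; z≤n)
  open import Data.Nat.Properties
  open import Data.Product using (∃; proj₁; proj₂)
  open import Data.Sum using (_⊎_; inj₁; inj₂; [_,_]′)
  open import Relation.Nullary using (¬_; yes; no; contradiction)
  open import Relation.Binary.Definitions using (tri<; tri≈; tri>)
  open import Relation.Binary.PropositionalEquality using (_≡_; refl; sym)

  record Least (P : ℕ → Set) : Set where
    field
      value : ℕ
      holds : P value
      minimal : ∀ {m} → m < value → ¬ P m

  private
    search : ∀ (P : ℕ → Set) b → (∀ {m} → m < b → ¬ P m) ⊎ Least P
    search P zero = inj₁ λ ()
    search P (suc b) with search P b
    ... | inj₂ l = inj₂ l
    ... | inj₁ none with em {P b}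
    ...   | yes pb = inj₂ record { value = b ; holds = pb ; minimal = none }
    ...   | no ¬pb = inj₁ λ m<1+b → [ none , (λ { refl → ¬pb }) ]′ (m<1+n⇒m<n∨m≡n m<1+b)

  least : ∀ {P : ℕ → Set} {n} → P n → Least P
  least {P} {n} pn with search P (suc n)
  ... | inj₁ none = contradiction pn (none (n<1+n n))
  ... | inj₂ l = l

  module Enumeration (P : ℕ → Set) (unbounded : ∀ m → ∃ λ n → m < n × P n) where

    first : Least P
    first = least (proj₂ (proj₂ (unbounded 0)))

    next : (m : ℕ) → Least (λ n → m < n × P n)
    next m = least (proj₂ (unbounded m))

    enum : ℕ → ℕ
    enum zero = Least.value first
    enum (suc i) = Least.value (next (enum i))

    enum-P : ∀ i → P (enum i)
    enum-P zero = Least.holds first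
    enum-P (suc i) = proj₂ (Least.holds (next (enum i)))

    enum-< : ∀ i → enum i < enum (suc i)
    enum-< i = proj₁ (Least.holds (next (enum i)))

    enum-strictMono : ∀ {i j} → i < j → enum i < enum j
    enum-strictMono {i} {suc j} i<1+j with m<1+n⇒m<n∨m≡n i<1+j
    ... | inj₁ i<j = <-trans (enum-strictMono i<j) (enum-< j)
    ... | inj₂ refl = enum-< i

    enum-cancel-< : ∀ {i j} → enum i < enum j → i < j
    enum-cancel-< {i} {j} lt with <-cmp i j
    ... | tri< i<j _ _ = i<j
    ... | tri≈ _ refl _ = contradiction lt (<-irrefl refl)
    ... | tri> _ _ j<i = contradiction lt (<-asym (enum-strictMono j<i))

    enum-injective : ∀ {i j} → enum i ≡ enum j → i ≡ j
    enum-injective {i} {j} eq with <-cmp i j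
    ... | tri< i<j _ _ = contradiction eq (<⇒≢ (enum-strictMono i<j))
    ... | tri≈ _ i≡j _ = i≡j
    ... | tri> _ _ j<i = contradiction (sym eq) (<⇒≢ (enum-strictMono j<i))

    i≤enum : ∀ i → i ≤ enum i
    i≤enum zero = z≤n
    i≤enum (suc i) = ≤-<-trans (i≤enum i) (enum-< i)

    enum-surjective : ∀ {n} → P n → ∃ λ i → enum i ≡ n
    enum-surjective {n} pn = search-below n (i≤enum n)
      where
        search-below : ∀ i → n ≤ enum i → ∃ λ i → enum i ≡ n
        search-below zero n≤e with m≤n⇒m<n∨m≡n n≤e
        ... | inj₁ n<e = contradiction pn (Least.minimal first n<e)
        ... | inj₂ n≡e = zero , sym n≡e
        search-below (suc i) n≤e′ with <-cmp n (enum i)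
        ... | tri< n<e _ _ = search-below i (<⇒≤ n<e)
        ... | tri≈ _ n≡e _ = i , sym n≡e
        ... | tri> _ _ e<n with m≤n⇒m<n∨m≡n n≤e′
        ...   | inj₁ n<e′ = contradiction (e<n , pn) (Least.minimal (next (enum i)) n<e′)
        ...   | inj₂ n≡e′ = suc i , sym n≡e′

module PerfectSpaces where
  open import Axiom.DoubleNegationElimination using (em⇒dne)
  open import Data.Nat using (ℕ; zero; suc; _+_; _≤_; _<_; _⊔_; z≤n)
  open import Data.Nat.Properties
  open import Data.List using (List; []; _∷_; _++_)
  open import Data.Product using (∃; ∃₂; proj₁; proj₂)
  open import Data.Sum using (_⊎_; inj₁; inj₂; [_,_]′)
  open import Data.Unit using (⊤; tt)
  open import Function.Bundles using (_⇔_; mk⇔; Equivalence)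
  open import Relation.Nullary using (¬_; yes; no; contradiction)
  open import Relation.Nullary.Decidable using (toSum)
  open import Relation.Binary.Definitions using (tri<; tri≈; tri>)
  open import Relation.Binary.PropositionalEquality using (_≡_; refl; sym; trans; cong; subst)

  -- A countable set with a descending chain of equivalence relations: x ∼[ k ] y
  -- reads "x and y are 2⁻ᵏ-close" for an ultrametric, and points are only
  -- considered up to _≋_, the intersection of the chain.
  record CountablePerfectSpace : Set₁ where
    infix 4 _∼[_]_ _≋_
    field
      Carrier : Set
      _∼[_]_ : Carrier → ℕ → Carrier → Set
      ∼-refl : ∀ {k x} → x ∼[ k ] x
      ∼-sym : ∀ {k x y} → x ∼[ k ] y → y ∼[ k ] x
      ∼-trans : ∀ {k x y z} → x ∼[ k ] y → y ∼[ k ] z → x ∼[ k ] z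
      ∼-pred : ∀ {k x y} → x ∼[ suc k ] y → x ∼[ k ] y

    _≋_ : Carrier → Carrier → Set
    x ≋ y = ∀ k → x ∼[ k ] y

    field
      countable : Countable Carrier
      perfect : ∀ x k → ∃ λ y → ¬ y ≋ x × y ∼[ k ] x

    ∼-antimono : ∀ {i j x y} → i ≤ j → x ∼[ j ] y → x ∼[ i ] y
    ∼-antimono {j = zero} z≤n x∼y = x∼y
    ∼-antimono {j = suc j} i≤1+j x∼y with m≤n⇒m<n∨m≡n i≤1+j
    ... | inj₁ i<1+j = ∼-antimono (≤-pred i<1+j) (∼-pred x∼y)
    ... | inj₂ refl = x∼y

    Congruent₂ : (Carrier → Carrier → Carrier) → Set
    Congruent₂ _∙_ = ∀ {k x x′ y y′} → x′ ∼[ k ] x → y′ ∼[ k ] y → (x′ ∙ y′) ∼[ k ] (x ∙ y)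

    Continuous₂ᶠ : (Carrier → Carrier → Carrier) → Set
    Continuous₂ᶠ _∙_ = ∀ x y k → ∃ λ j →
      ∀ {x′ y′} → x′ ∼[ j ] x → y′ ∼[ j ] y → (x′ ∙ y′) ∼[ k ] (x ∙ y)

    ≋-sym : ∀ {x y} → x ≋ y → y ≋ x
    ≋-sym x≋y k = ∼-sym (x≋y k)

    ≋-trans : ∀ {x y z} → x ≋ y → y ≋ z → x ≋ z
    ≋-trans x≋y y≋z k = ∼-trans (x≋y k) (y≋z k)

  -- Every point gets an address in an ℕ-branching tree of clopen sets: a node
  -- is split into its centre (its first element in the enumeration) and
  -- children grouping the other points by the level at which they leave the
  -- centre.  Each point is the centre of the node at its address.
  module Tree (em : ExcludedMiddle 0ℓ) (S : CountablePerfectSpace) where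
    open CountablePerfectSpace S
    open Classical em

    enumerate : ℕ → Carrier
    enumerate = proj₁ countable

    SeparatesAt : Carrier → Carrier → ℕ → Set
    SeparatesAt c w L = (∀ {i} → i < L → w ∼[ i ] c) × ¬ w ∼[ L ] c

    dne : ∀ {P : Set} → ¬ ¬ P → P
    dne = em⇒dne em

    separation : ∀ {c w} → ¬ w ≋ c → ∃ (SeparatesAt c w)
    separation {c} {w} w≉c = value , (λ i<L → dne (minimal i<L)) , holds
      where
        somewhereApart : ∃ λ L → ¬ w ∼[ L ] c
        somewhereApart = dne λ nowhere → w≉c λ k → dne λ w≁c → nowhere (k , w≁c)
        open Least (least {λ L → ¬ w ∼[ L ] c} (proj₂ somewhereApart))

    separatesAt-apart : ∀ {c w L} → SeparatesAt c w L → ¬ w ≋ c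
    separatesAt-apart (_ , w≁c) w≋c = w≁c (w≋c _)

    separatesAt-above : ∀ {c w L j} → SeparatesAt c w L → w ∼[ j ] c → j < L
    separatesAt-above (_ , w≁c) w∼c = ≰⇒> λ L≤j → w≁c (∼-antimono L≤j w∼c)

    separatesAt-unique : ∀ {c w L L′} → SeparatesAt c w L → SeparatesAt c w L′ → L ≡ L′
    separatesAt-unique sep@(close , _) sep′@(close′ , _) with <-cmp _ _
    ... | tri< L<L′ _ _ = contradiction (separatesAt-above sep (close′ L<L′)) (<-irrefl refl)
    ... | tri≈ _ L≡L′ _ = L≡L′
    ... | tri> _ _ L′<L = contradiction (separatesAt-above sep′ (close L′<L)) (<-irrefl refl)

    separatesAt-transfer : ∀ {c w z L} → SeparatesAt c w L → z ∼[ L ] w → SeparatesAt c z L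
    separatesAt-transfer (close , w≁c) z∼w =
      (λ i<L → ∼-trans (∼-antimono (<⇒≤ i<L) z∼w) (close i<L)) , λ z∼c → w≁c (∼-trans (∼-sym z∼w) z∼c)

    -- Without eta, comparing two nodes never unfolds them into their fields.
    record Node : Set₁ where
      no-eta-equality
      field
        member : Carrier → Set
        inhabited : ∃ member
        locallyConstant : ∀ z → ∃ λ j → ∀ {w} → w ∼[ j ] z → member w ⇔ member z

    open Node

    infix 4 _∈_
    _∈_ : Carrier → Node → Set
    x ∈ N = member N x

    ∈-resp-≋ : ∀ N {w z} → w ≋ z → w ∈ N → z ∈ N
    ∈-resp-≋ N {z = z} w≋z = Equivalence.to (proj₂ (locallyConstant N z) (w≋z _))

    firstIndex : ∀ N → Least (λ n → enumerate n ∈ N)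
    firstIndex N with inhabited N
    ... | z , z∈N with proj₂ countable z
    ...   | n , refl = least z∈N

    index : Node → ℕ
    index N = Least.value (firstIndex N)

    center : Node → Carrier
    center N = enumerate (index N)

    center-∈ : ∀ N → center N ∈ N
    center-∈ N = Least.holds (firstIndex N)

    index-minimal : ∀ N {n} → enumerate n ∈ N → index N ≤ n
    index-minimal N en∈N = ≮⇒≥ λ n<index → Least.minimal (firstIndex N) n<index en∈N

    module Children (N : Node) where
      private
        c = center N

      Attained : ℕ → Set
      Attained L = ∃ λ w → w ∈ N × SeparatesAt c w L

      attained-unbounded : ∀ m → ∃ λ L → m < L × Attained L
      attained-unbounded m with locallyConstant N c
      ... | j , near⇒∈ with perfect c (m ⊔ j)
      ...   | w , w≉c , w∼c with separation w≉c
      ...     | L , sep = L , ≤-<-trans (m≤m⊔n m j) (separatesAt-above sep w∼c)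
                            , w , Equivalence.from (near⇒∈ (∼-antimono (m≤n⊔m m j) w∼c)) (center-∈ N) , sep

      open Enumeration Attained attained-unbounded public
        renaming (enum to level; enum-P to level-attained)

      child : ℕ → Node
      member (child i) w = w ∈ N × SeparatesAt c w (level i)
      inhabited (child i) with level-attained i
      ... | w , w∈N , sep = w , w∈N , sep
      locallyConstant (child i) z with locallyConstant N z
      ... | j , near⇒∈ = j ⊔ level i , λ w∼z → mk⇔
        (λ (w∈N , sep) → Equivalence.to (near⇒∈ (∼-antimono (m≤m⊔n j _) w∼z)) w∈N
                        , separatesAt-transfer sep (∼-sym (∼-antimono (m≤n⊔m j _) w∼z)))
        (λ (z∈N , sep) → Equivalence.from (near⇒∈ (∼-antimono (m≤m⊔n j _) w∼z)) z∈N
                        , separatesAt-transfer sep (∼-antimono (m≤n⊔m j _) w∼z))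

    open Children using (child; level)

    child-⊆ : ∀ N i {w} → w ∈ child N i → w ∈ N
    child-⊆ N i (w∈N , _) = w∈N

    child-apart : ∀ N i {w} → w ∈ child N i → ¬ w ≋ center N
    child-apart N i (_ , sep) = separatesAt-apart sep

    child-close : ∀ N i {w k} → w ∈ child N i → k < i → w ∼[ k ] center N
    child-close N i (_ , close , _) k<i = close (<-≤-trans k<i (Children.i≤enum N i))

    child-far : ∀ N i {w k} → w ∈ child N i → w ∼[ level N k ] center N → k < i
    child-far N i (_ , sep) w∼c = Children.enum-cancel-< N (separatesAt-above sep w∼c)

    child-disjoint : ∀ N i j {w} → w ∈ child N i → w ∈ child N j → i ≡ j
    child-disjoint N i j (_ , sepᵢ) (_ , sepⱼ) = Children.enum-injective N (separatesAt-unique sepᵢ sepⱼ)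

    child-cover : ∀ N {w} → w ∈ N → ¬ w ≋ center N → ∃ λ i → w ∈ child N i
    child-cover N {w} w∈N w≉c with separation w≉c
    ... | L , sep with Children.enum-surjective N (w , w∈N , sep)
    ...   | i , refl = i , w∈N , sep

    index-child : ∀ N i → index N < index (child N i)
    index-child N i = ≤∧≢⇒< (index-minimal N (child-⊆ N i (center-∈ (child N i)))) λ eq →
      child-apart N i (center-∈ (child N i)) (subst (λ n → enumerate n ≋ center N) eq (λ _ → ∼-refl))

    descendant : Node → List ℕ → Node
    descendant N [] = N
    descendant N (i ∷ s) = descendant (child N i) s

    descendant-⊆ : ∀ N s {w} → w ∈ descendant N s → w ∈ N
    descendant-⊆ N [] w∈ = w∈
    descendant-⊆ N (i ∷ s) w∈ = child-⊆ N i (descendant-⊆ (child N i) s w∈)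

    descendant-++ : ∀ N s t → descendant N (s ++ t) ≡ descendant (descendant N s) t
    descendant-++ N [] t = refl
    descendant-++ N (i ∷ s) t = descendant-++ (child N i) s t

    center-descendant-∈ : ∀ N i s → center (descendant N (i ∷ s)) ∈ child N i
    center-descendant-∈ N i s = descendant-⊆ (child N i) s (center-∈ (descendant N (i ∷ s)))

    center-descendant-injective : ∀ N s t → center (descendant N s) ≋ center (descendant N t) → s ≡ t
    center-descendant-injective N [] [] _ = refl
    center-descendant-injective N [] (j ∷ t) c≋c′ =
      contradiction (≋-sym c≋c′) (child-apart N j (center-descendant-∈ N j t))
    center-descendant-injective N (i ∷ s) [] c≋c′ =
      contradiction c≋c′ (child-apart N i (center-descendant-∈ N i s))
    center-descendant-injective N (i ∷ s) (j ∷ t) c≋c′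
      with child-disjoint N i j (center-descendant-∈ N i s)
             (∈-resp-≋ (child N j) (≋-sym c≋c′) (center-descendant-∈ N j t))
    ... | refl = cong (i ∷_) (center-descendant-injective (child N i) s t c≋c′)

    Addressed : Node → Carrier → Set
    Addressed N x = ∃ λ s → x ≋ center (descendant N s)

    -- The fuel n suffices: the index of the centre grows strictly along the
    -- path, and stays ≤ n as long as x = enumerate n is a member.
    addressed : ∀ N {x} → x ∈ N → Addressed N x
    addressed N {x} x∈N with proj₂ countable x
    ... | n , refl = search n N x∈N (m≤m+n n (index N))
      where
        search : ∀ fuel N → enumerate n ∈ N → n ≤ fuel + index N → Addressed N (enumerate n)
        search fuel N x∈N bound with em {enumerate n ≋ center N}
        ... | yes x≋c = [] , x≋c
        ... | no x≉c with child-cover N x∈N x≉c | fuel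
        ...   | i , x∈child | zero = contradiction (≤-<-trans bound (index-child N i))
                                                     (≤⇒≯ (index-minimal (child N i) x∈child))
        ...   | i , x∈child | suc f with search f (child N i) x∈child
                                        (≤-trans bound (≤-trans (≤-reflexive (sym (+-suc f (index N))))
                                                                (+-monoʳ-≤ f (index-child N i))))
        ...     | s , x≋c = i ∷ s , x≋c

    root : Node
    member root _ = ⊤
    inhabited root = enumerate 0 , tt
    locallyConstant root _ = 0 , λ _ → mk⇔ _ _

    Address : Set
    Address = List ℕ

    address : Carrier → Address
    address x = proj₁ (addressed root {x} tt)

    point : Address → Carrier
    point s = center (descendant root s)

    point-address : ∀ x → x ≋ point (address x)
    point-address x = proj₂ (addressed root {x} tt)

    address-cong : ∀ {x y} → x ≋ y → address x ≡ address y
    address-cong {x} {y} x≋y = center-descendant-injective root _ _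
      (≋-trans (≋-sym (point-address x)) (≋-trans x≋y (point-address y)))

    address-point : ∀ s → address (point s) ≡ s
    address-point s = center-descendant-injective root _ _ (≋-sym (point-address (point s)))

    point-++ : ∀ s t → point (s ++ t) ≡ center (descendant (descendant root s) t)
    point-++ s t = cong center (descendant-++ root s t)

    point-extension-close : ∀ s {i k} t → k < i → point (s ++ i ∷ t) ∼[ k ] point s
    point-extension-close s {i} t k<i = subst (_∼[ _ ] point s) (sym (point-++ s (i ∷ t)))
      (child-close (descendant root s) i (center-descendant-∈ (descendant root s) i t) k<i)

    address-near : ∀ x k → ∃ λ j → ∀ {y} → y ∼[ j ] x →
                   y ≋ x ⊎ ∃₂ λ i t → k < i × address y ≡ address x ++ i ∷ t
    address-near x k = jN ⊔ level N k , λ {y} y∼x →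
      [ inj₁ , (λ y≉x → inj₂ (descend y∼x y≉x)) ]′ (toSum (em {y ≋ x}))
      where
        N = descendant root (address x)
        x≋c : x ≋ center N
        x≋c = point-address x
        jN = proj₁ (locallyConstant N x)
        descend : ∀ {y} → y ∼[ jN ⊔ level N k ] x → ¬ y ≋ x →
                  ∃₂ λ i t → k < i × address y ≡ address x ++ i ∷ t
        descend {y} y∼x y≉x =
          let y∈N = Equivalence.from (proj₂ (locallyConstant N x) (∼-antimono (m≤m⊔n jN (level N k)) y∼x))
                                     (∈-resp-≋ N (≋-sym x≋c) (center-∈ N))
              i , y∈child = child-cover N y∈N (λ y≋c → y≉x (≋-trans y≋c (≋-sym x≋c)))
              t , y≋c = addressed (child N i) y∈child
              y∼c : y ∼[ level N k ] center N
              y∼c = ∼-trans (∼-antimono (m≤n⊔m jN (level N k)) y∼x) (x≋c (level N k))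
          in  i , t , child-far N i {k = k} y∈child y∼c
                , trans (address-cong (subst (y ≋_) (sym (point-++ (address x) (i ∷ t))) y≋c))
                        (address-point (address x ++ i ∷ t))

  -- Sierpiński: matching points with equal addresses is a homeomorphism between
  -- any two countable perfect spaces.
  module AddressMap (em : ExcludedMiddle 0ℓ) (A B : CountablePerfectSpace) where
    private
      module A = CountablePerfectSpace A
      module B = CountablePerfectSpace B
      module TA = Tree em A
      module TB = Tree em B

    to : A.Carrier → B.Carrier
    to x = TB.point (TA.address x)

    to-cong : ∀ {x y} → x A.≋ y → to x ≡ to y
    to-cong x≋y = cong TB.point (TA.address-cong x≋y)

    to-continuous : ∀ x k → ∃ λ j → ∀ {y} → y A.∼[ j ] x → to y B.∼[ k ] to x
    to-continuous x k = let j , near = TA.address-near x k in j , λ y∼x → close (near y∼x)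
      where
        close : ∀ {y} → y A.≋ x ⊎ (∃₂ λ i t → k < i × TA.address y ≡ TA.address x ++ i ∷ t) →
                to y B.∼[ k ] to x
        close (inj₁ y≋x) = subst (B._∼[ k ] to x) (sym (to-cong y≋x)) B.∼-refl
        close (inj₂ (i , t , k<i , extends)) =
          subst (λ s → TB.point s B.∼[ k ] to x) (sym extends) (TB.point-extension-close (TA.address x) t k<i)

    from-to : ∀ x → TA.point (TB.address (to x)) A.≋ x
    from-to x = subst (λ s → TA.point s A.≋ x) (sym (TB.address-point (TA.address x)))
                  (A.≋-sym (TA.point-address x))

  module Conjugation (em : ExcludedMiddle 0ℓ) (A B : CountablePerfectSpace) where
    private
      module A = CountablePerfectSpace A
      module B = CountablePerfectSpace B
      module AB = AddressMap em A B
      module BA = AddressMap em B A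

    -- Opaque, so that unification never unfolds the address computations.
    opaque
      to : A.Carrier → B.Carrier
      to = AB.to

      from : B.Carrier → A.Carrier
      from = BA.to

      from-cong : ∀ {x y} → x B.≋ y → from x ≡ from y
      from-cong = BA.to-cong

      to-continuous : ∀ x k → ∃ λ j → ∀ {y} → y A.∼[ j ] x → to y B.∼[ k ] to x
      to-continuous = AB.to-continuous

      from-continuous : ∀ y k → ∃ λ j → ∀ {z} → z B.∼[ j ] y → from z A.∼[ k ] from y
      from-continuous = BA.to-continuous

      from-to : ∀ x → from (to x) A.≋ x
      from-to = AB.from-to

      to-from : ∀ y → to (from y) B.≋ y
      to-from = BA.from-to

    to-injective : ∀ {x y} → to x B.≋ to y → x A.≋ y
    to-injective {x} {y} tx≋ty =
      A.≋-trans (A.≋-sym (from-to x)) (subst (A._≋ y) (sym (from-cong tx≋ty)) (from-to y))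

    conjugate : (B.Carrier → B.Carrier → B.Carrier) → A.Carrier → A.Carrier → A.Carrier
    conjugate _∙_ x y = from (to x ∙ to y)

    conjugate-continuous : ∀ {_∙_} → B.Congruent₂ _∙_ → A.Continuous₂ᶠ (conjugate _∙_)
    conjugate-continuous {_∙_} ∙-cong x y k =
      let j , from-near = from-continuous (to x ∙ to y) k
          jₓ , to-nearₓ = to-continuous x j
          jᵧ , to-nearᵧ = to-continuous y j
      in  jₓ ⊔ jᵧ , λ x′∼x y′∼y → from-near (∙-cong (to-nearₓ (A.∼-antimono (m≤m⊔n jₓ jᵧ) x′∼x))
                                                     (to-nearᵧ (A.∼-antimono (m≤n⊔m jₓ jᵧ) y′∼y)))

module ModelIntegers where
  open import Data.Nat using (ℕ; zero; suc)
  open import Data.Product using (∃; ∃₂; proj₁; proj₂)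
  open import Data.Sum using (inj₁; inj₂)
  open import Relation.Nullary using (¬_; contradiction)
  open import Relation.Binary.PropositionalEquality
    using (_≡_; refl; sym; trans; cong; cong₂; subst; subst₂; isEquivalence; module ≡-Reasoning)
  open import Algebra.Bundles using (CommutativeSemiring)
  open import Algebra.Structures using (IsCommutativeSemiring)
  open Countability using (countable-×)
  open PerfectSpaces using (CountablePerfectSpace)

  module PAminus (M : Structure) (pa : Structure.IsPAminus M) where
    open Structure M public
      renaming ( zero to 𝟘; one to 𝟙; _+_ to infixl 6 _+_; _*_ to infixl 7 _*_
               ; _<_ to infix 4 _<_; _≤_ to infix 4 _≤_)
    open IsPAminus pa public

    +-identityˡ : ∀ x → 𝟘 + x ≡ x
    +-identityˡ x = trans (+-comm 𝟘 x) (+-identity x)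

    *-identityˡ : ∀ x → 𝟙 * x ≡ x
    *-identityˡ x = trans (*-comm 𝟙 x) (*-identity x)

    *-zeroˡ : ∀ x → 𝟘 * x ≡ 𝟘
    *-zeroˡ x = trans (*-comm 𝟘 x) (*-zero x)

    distribʳ : ∀ x y z → (y + z) * x ≡ y * x + z * x
    distribʳ x y z = trans (*-comm (y + z) x) (trans (distrib x y z) (cong₂ _+_ (*-comm x y) (*-comm x z)))

    isCommutativeSemiring : IsCommutativeSemiring _≡_ _+_ _*_ 𝟘 𝟙
    isCommutativeSemiring = record
      { isSemiring = record
        { isSemiringWithoutAnnihilatingZero = record
          { +-isCommutativeMonoid = record
            { isMonoid = record
              { isSemigroup = record
                { isMagma = record { isEquivalence = isEquivalence ; ∙-cong = cong₂ _+_ }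
                ; assoc = +-assoc }
              ; identity = +-identityˡ , +-identity }
            ; comm = +-comm }
          ; *-cong = cong₂ _*_
          ; *-assoc = *-assoc
          ; *-identity = *-identityˡ , *-identity
          ; distrib = distrib , distribʳ }
        ; zero = *-zeroˡ , *-zero }
      ; *-comm = *-comm }

    commutativeSemiring : CommutativeSemiring 0ℓ 0ℓ
    commutativeSemiring = record { isCommutativeSemiring = isCommutativeSemiring }

    open import Algebra.Solver.Ring.NaturalCoefficients.Default commutativeSemiring public
      using (solve; _:=_; _:+_; _:*_)

    <-≤-trans : ∀ {x y z} → x < y → y ≤ z → x < z
    <-≤-trans x<y (inj₁ y<z) = <-trans _ _ _ x<y y<z
    <-≤-trans x<y (inj₂ refl) = x<y

    ≤-<-trans : ∀ {x y z} → x ≤ y → y < z → x < z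
    ≤-<-trans (inj₁ x<y) y<z = <-trans _ _ _ x<y y<z
    ≤-<-trans (inj₂ refl) y<z = y<z

    ≤-trans : ∀ {x y z} → x ≤ y → y ≤ z → x ≤ z
    ≤-trans (inj₁ x<y) y≤z = inj₁ (<-≤-trans x<y y≤z)
    ≤-trans (inj₂ refl) y≤z = y≤z

    x≤x+y : ∀ x y → x ≤ x + y
    x≤x+y x y with nonneg y
    ... | inj₁ 0<y = inj₁ (subst₂ _<_ (+-identityˡ x) (+-comm y x) (+-mono-< 𝟘 y x 0<y))
    ... | inj₂ refl = inj₂ (sym (+-identity x))

    y≤x+y : ∀ x y → y ≤ x + y
    y≤x+y x y = subst (y ≤_) (+-comm y x) (x≤x+y y x)

    x<1+x : ∀ x → x < 𝟙 + x
    x<1+x x = subst (_< 𝟙 + x) (+-identityˡ x) (+-mono-< 𝟘 𝟙 x 0<1)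

    +-cancelʳ : ∀ {x y} z → x + z ≡ y + z → x ≡ y
    +-cancelʳ {x} {y} z eq with <-trichotomy x y
    ... | inj₁ x<y = contradiction (subst (x + z <_) (sym eq) (+-mono-< x y z x<y)) (<-irrefl _)
    ... | inj₂ (inj₁ x≡y) = x≡y
    ... | inj₂ (inj₂ y<x) = contradiction (subst (_< x + z) (sym eq) (+-mono-< y x z y<x)) (<-irrefl _)

    0<1+x : ∀ x → 𝟘 < 𝟙 + x
    0<1+x x = <-≤-trans 0<1 (x≤x+y 𝟙 x)

    *-pos : ∀ {x y} → 𝟘 < x → 𝟘 < y → 𝟘 < x * y
    *-pos {x} {y} 0<x 0<y = subst (_< x * y) (*-zeroˡ y) (*-mono-< 𝟘 x y 0<y 0<x)

    x≤x*y : ∀ x {y} → 𝟘 < y → x ≤ x * y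
    x≤x*y x {y} 0<y with nonneg x
    ... | inj₂ refl = inj₂ (sym (*-zeroˡ y))
    ... | inj₁ 0<x with discrete y 0<y
    ...   | inj₁ 1<y = inj₁ (subst₂ _<_ (*-identityˡ x) (*-comm y x) (*-mono-< 𝟙 y x 0<x 1<y))
    ...   | inj₂ refl = inj₂ (sym (*-identity x))

    <⇒∃+pos : ∀ {x y} → x < y → ∃ λ r → 𝟘 < r × x + r ≡ y
    <⇒∃+pos {x} {y} x<y with <⇒∃+ x y x<y
    ... | r , x+r≡y with nonneg r
    ...   | inj₁ 0<r = r , 0<r , x+r≡y
    ...   | inj₂ refl = contradiction (subst (x <_) (trans (sym x+r≡y) (+-identity x)) x<y) (<-irrefl x)

    private
      no-overshoot : ∀ {n u v p r} → 𝟘 < r → u + n * (p + r) ≡ v + n * p → ¬ v < n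
      no-overshoot {n} {u} {v} {p} {r} 0<r eq v<n = <-irrefl v (<-≤-trans v<n n≤v)
        where
          u+nr≡v : u + n * r ≡ v
          u+nr≡v = +-cancelʳ (n * p)
            (trans (solve 4 (λ u n p r → u :+ n :* r :+ n :* p := u :+ n :* (p :+ r)) refl u n p r) eq)
          n≤v : n ≤ v
          n≤v = ≤-trans (x≤x*y n 0<r) (≤-trans (y≤x+y u (n * r)) (inj₂ u+nr≡v))

    remainder-unique : ∀ {n u v p q} → u + n * q ≡ v + n * p → u < n → v < n → u ≡ v
    remainder-unique {n} {p = p} {q} eq u<n v<n with <-trichotomy p q
    ... | inj₂ (inj₁ refl) = +-cancelʳ (n * p) eq
    ... | inj₁ p<q with <⇒∃+pos p<q
    ...   | r , 0<r , refl = contradiction v<n (no-overshoot 0<r eq)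
    remainder-unique {n} {p = p} {q} eq u<n v<n | inj₂ (inj₂ q<p) with <⇒∃+pos q<p
    ...   | r , 0<r , refl = contradiction u<n (no-overshoot 0<r (sym eq))

  module Congruence (M : Structure) (pa : Structure.IsPAminus M) where
    open PAminus M pa
    open IntegersOf M using (ℤᴹ)
      renaming (_≈ᶻ_ to infix 4 _≈ᶻ_; _+ᶻ_ to infixl 6 _+ᶻ_; _*ᶻ_ to infixl 7 _*ᶻ_)
    open ≡-Reasoning

    -- a - b ≡ a′ - b′ (mod n), stated without subtraction.
    infix 4 _≡_[mod_]
    _≡_[mod_] : ℤᴹ → ℤᴹ → Carrier → Set
    (a , b) ≡ (a′ , b′) [mod n ] = ∃₂ λ p q → a + b′ + n * q ≡ a′ + b + n * p

    ≈ᶻ⇒≡-mod : ∀ {x y} n → x ≈ᶻ y → x ≡ y [mod n ]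
    ≈ᶻ⇒≡-mod n x≈y = 𝟘 , 𝟘 , cong (_+ n * 𝟘) x≈y

    ≡-mod-refl : ∀ {x n} → x ≡ x [mod n ]
    ≡-mod-refl = 𝟘 , 𝟘 , refl

    ≡-mod-sym : ∀ {x y n} → x ≡ y [mod n ] → y ≡ x [mod n ]
    ≡-mod-sym (p , q , eq) = q , p , sym eq

    ≡-mod-trans : ∀ {x y z n} → x ≡ y [mod n ] → y ≡ z [mod n ] → x ≡ z [mod n ]
    ≡-mod-trans {a , b} {a′ , b′} {a″ , b″} {n} (p , q , e₁) (p′ , q′ , e₂) =
      p + p′ , q + q′ , +-cancelʳ (a′ + b′) (begin
        a + b″ + n * (q + q′) + (a′ + b′)       ≡⟨ solve 7 (λ a b′ a′ b″ n q q′ →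
                                                      a :+ b″ :+ n :* (q :+ q′) :+ (a′ :+ b′)
                                                   := a :+ b′ :+ n :* q :+ (a′ :+ b″ :+ n :* q′)) refl a b′ a′ b″ n q q′ ⟩
        a + b′ + n * q + (a′ + b″ + n * q′)     ≡⟨ cong₂ _+_ e₁ e₂ ⟩
        a′ + b + n * p + (a″ + b′ + n * p′)     ≡⟨ solve 7 (λ a′ b a″ b′ n p p′ →
                                                      a′ :+ b :+ n :* p :+ (a″ :+ b′ :+ n :* p′)
                                                   := a″ :+ b :+ n :* (p :+ p′) :+ (a′ :+ b′)) refl a′ b a″ b′ n p p′ ⟩
        a″ + b + n * (p + p′) + (a′ + b′)       ∎)

    ≡-mod-divisor : ∀ {x y} n m → x ≡ y [mod n * m ] → x ≡ y [mod n ]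
    ≡-mod-divisor {a , b} {a′ , b′} n m (p , q , eq) = m * p , m * q ,
      trans (cong (a + b′ +_) (sym (*-assoc n m q))) (trans eq (cong (a′ + b +_) (*-assoc n m p)))

    +ᶻ-cong-mod : ∀ {x x′ y y′ n} → x ≡ x′ [mod n ] → y ≡ y′ [mod n ] → x +ᶻ y ≡ x′ +ᶻ y′ [mod n ]
    +ᶻ-cong-mod {a , b} {a′ , b′} {c , d} {c′ , d′} {n} (p , q , e₁) (p′ , q′ , e₂) =
      p + p′ , q + q′ , (begin
        a + c + (b′ + d′) + n * (q + q′)        ≡⟨ solve 7 (λ a c b′ d′ n q q′ →
                                                      a :+ c :+ (b′ :+ d′) :+ n :* (q :+ q′)
                                                   := a :+ b′ :+ n :* q :+ (c :+ d′ :+ n :* q′)) refl a c b′ d′ n q q′ ⟩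
        a + b′ + n * q + (c + d′ + n * q′)      ≡⟨ cong₂ _+_ e₁ e₂ ⟩
        a′ + b + n * p + (c′ + d + n * p′)      ≡⟨ solve 7 (λ a′ b c′ d n p p′ →
                                                      a′ :+ b :+ n :* p :+ (c′ :+ d :+ n :* p′)
                                                   := a′ :+ c′ :+ (b :+ d) :+ n :* (p :+ p′)) refl a′ b c′ d n p p′ ⟩
        a′ + c′ + (b + d) + n * (p + p′)        ∎)

    *ᶻ-congʳ-mod : ∀ {x x′ n} y → x ≡ x′ [mod n ] → x *ᶻ y ≡ x′ *ᶻ y [mod n ]
    *ᶻ-congʳ-mod {a , b} {a′ , b′} {n} (c , d) (p , q , eq) =
      p * c + q * d , q * c + p * d , (begin
        a * c + b * d + (a′ * d + b′ * c) + n * (q * c + p * d)   ≡⟨ solve 9 (λ a b a′ b′ c d n p q →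
                                            a :* c :+ b :* d :+ (a′ :* d :+ b′ :* c) :+ n :* (q :* c :+ p :* d)
                                         := (a :+ b′ :+ n :* q) :* c :+ (a′ :+ b :+ n :* p) :* d) refl a b a′ b′ c d n p q ⟩
        (a + b′ + n * q) * c + (a′ + b + n * p) * d               ≡⟨ cong₂ (λ u v → u * c + v * d) eq (sym eq) ⟩
        (a′ + b + n * p) * c + (a + b′ + n * q) * d               ≡⟨ solve 9 (λ a b a′ b′ c d n p q →
                                            (a′ :+ b :+ n :* p) :* c :+ (a :+ b′ :+ n :* q) :* d
                                         := a′ :* c :+ b′ :* d :+ (a :* d :+ b :* c) :+ n :* (p :* c :+ q :* d)) refl a b a′ b′ c d n p q ⟩
        a′ * c + b′ * d + (a * d + b * c) + n * (p * c + q * d)   ∎)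

    *ᶻ-comm : ∀ x y → x *ᶻ y ≈ᶻ y *ᶻ x
    *ᶻ-comm (a , b) (c , d) =
      solve 4 (λ a b c d → a :* c :+ b :* d :+ (c :* b :+ d :* a) := c :* a :+ d :* b :+ (a :* d :+ b :* c)) refl a b c d

    *ᶻ-cong-mod : ∀ {x x′ y y′ n} → x ≡ x′ [mod n ] → y ≡ y′ [mod n ] → x *ᶻ y ≡ x′ *ᶻ y′ [mod n ]
    *ᶻ-cong-mod {x} {x′} {y} {y′} {n} x≡x′ y≡y′ =
      ≡-mod-trans (*ᶻ-congʳ-mod y x≡x′) (≡-mod-trans (≈ᶻ⇒≡-mod n (*ᶻ-comm x′ y))
        (≡-mod-trans (*ᶻ-congʳ-mod x′ y≡y′) (≈ᶻ⇒≡-mod n (*ᶻ-comm y′ x′))))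

    ≡-mod-small⇒≈ᶻ : ∀ {a b a′ b′ n} → (a , b) ≡ (a′ , b′) [mod n ] → a + b′ < n → a′ + b < n →
                     (a , b) ≈ᶻ (a′ , b′)
    ≡-mod-small⇒≈ᶻ (p , q , eq) = remainder-unique eq

  -- The moduli are chosen so that eₖ < nₖ₊₁ for the enumeration e of M.
  module ModularSpace (M : Structure) (pa : Structure.IsPAminus M)
                      (countable : Countable (Structure.Carrier M)) where
    open PAminus M pa
    open Congruence M pa
    open IntegersOf M using (ℤᴹ)
      renaming (_≈ᶻ_ to infix 4 _≈ᶻ_; _+ᶻ_ to infixl 6 _+ᶻ_; _*ᶻ_ to infixl 7 _*ᶻ_)

    private
      e : ℕ → Carrier
      e = proj₁ countable

    modulus : ℕ → Carrier
    modulus zero = 𝟙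
    modulus (suc k) = modulus k * (𝟙 + e k)

    modulus-pos : ∀ k → 𝟘 < modulus k
    modulus-pos zero = 0<1
    modulus-pos (suc k) = *-pos (modulus-pos k) (0<1+x (e k))

    below-modulus : ∀ x → ∃ λ k → x < modulus k
    below-modulus x with proj₂ countable x
    ... | k , refl = suc k , <-≤-trans (x<1+x (e k))
                            (subst (𝟙 + e k ≤_) (*-comm _ _) (x≤x*y (𝟙 + e k) (modulus-pos k)))

    ≡-mod-all⇒≈ᶻ : ∀ {x y} → (∀ k → x ≡ y [mod modulus k ]) → x ≈ᶻ y
    ≡-mod-all⇒≈ᶻ {a , b} {a′ , b′} x≡y with below-modulus (a + b′ + (a′ + b))
    ... | k , sum<n = ≡-mod-small⇒≈ᶻ (x≡y k) (≤-<-trans (x≤x+y _ _) sum<n) (≤-<-trans (y≤x+y _ _) sum<n)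

    perfect : ∀ x k → ∃ λ y → ¬ (∀ k → y ≡ x [mod modulus k ]) × y ≡ x [mod modulus k ]
    perfect (a , b) k = (a + n , b) , apart , 𝟙 , 𝟘 , close
      where
        n = modulus k
        close : a + n + b + n * 𝟘 ≡ a + b + n * 𝟙
        close rewrite *-zero n | +-identity (a + n + b) | *-identity n =
          solve 3 (λ a b n → a :+ n :+ b := a :+ b :+ n) refl a b n
        apart : ¬ (∀ k → (a + n , b) ≡ (a , b) [mod modulus k ])
        apart same = <-irrefl 𝟘 (subst (𝟘 <_) n≡0 (modulus-pos k))
          where
            n≡0 : n ≡ 𝟘
            n≡0 = +-cancelʳ (a + b) (trans (solve 3 (λ a b n → n :+ (a :+ b) := a :+ n :+ b) refl a b n)
                                          (trans (≡-mod-all⇒≈ᶻ same) (sym (+-identityˡ (a + b)))))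

    space : CountablePerfectSpace
    space = record
      { Carrier = ℤᴹ
      ; _∼[_]_ = λ x k y → x ≡ y [mod modulus k ]
      ; ∼-refl = ≡-mod-refl
      ; ∼-sym = ≡-mod-sym
      ; ∼-trans = ≡-mod-trans
      ; ∼-pred = λ {k} → ≡-mod-divisor (modulus k) (𝟙 + e k)
      ; countable = countable-× countable countable
      ; perfect = perfect
      }

module CubeRoots where
  open import Data.Nat using (zero; suc; _*_; _<_; z≤n; s≤s; z<s)
  open import Data.Nat.Properties using (*-comm; *-assoc; *-cancelˡ-≡; m<m*n; <-irrefl)
  open import Data.Nat.Divisibility using (_∣_; divides)
  open import Data.Nat.Primality using (euclidsLemma; prime[2])
  open import Data.Nat.Induction using (<-wellFounded)
  open import Data.Nat.Tactic.RingSolver using (solve-∀)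
  open import Induction.WellFounded using (Acc; acc)
  open import Data.Sum using (inj₁; inj₂)
  open import Data.Product using (∃₂)
  open import Relation.Nullary using (¬_; contradiction)
  open import Relation.Binary.PropositionalEquality using (_≡_; _≢_; refl; sym; trans)

  2∣cube⇒2∣ : ∀ a → 2 ∣ a * a * a → 2 ∣ a
  2∣cube⇒2∣ a 2∣a³ with euclidsLemma (a * a) a prime[2] 2∣a³
  ... | inj₂ 2∣a = 2∣a
  ... | inj₁ 2∣a² with euclidsLemma a a prime[2] 2∣a²
  ...   | inj₁ 2∣a = 2∣a
  ...   | inj₂ 2∣a = 2∣a

  private
    cube-double : ∀ m → m * 2 * (m * 2) * (m * 2) ≡ 8 * (m * m * m)
    cube-double = solve-∀

    cube-double′ : ∀ m → m * 2 * (m * 2) * (m * 2) ≡ 2 * (2 * (2 * (m * m * m)))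
    cube-double′ = solve-∀

    double-odd : ∀ o b → 2 * o * b ≡ o * b * 2
    double-odd = solve-∀

    double-odd-cube-double : ∀ o p → 2 * o * (p * 2 * (p * 2) * (p * 2)) ≡ 8 * (2 * o * (p * p * p))
    double-odd-cube-double = solve-∀

  halving : ∀ {o} → ¬ 2 ∣ o → ∀ a b → a * a * a ≡ 2 * o * (b * b * b) →
            ∃₂ λ m p → b ≡ p * 2 × m * m * m ≡ 2 * o * (p * p * p)
  halving {o} 2∤o a b a³≡2ob³
    with 2∣cube⇒2∣ a (divides (o * (b * b * b)) (trans a³≡2ob³ (double-odd o (b * b * b))))
  ... | divides m refl
    with euclidsLemma o (b * b * b) prime[2]
           (divides (2 * (m * m * m)) (trans (sym 4m³≡ob³) (*-comm 2 (2 * (m * m * m)))))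
    where
      4m³≡ob³ : 2 * (2 * (m * m * m)) ≡ o * (b * b * b)
      4m³≡ob³ = *-cancelˡ-≡ _ _ 2 (trans (sym (cube-double′ m)) (trans a³≡2ob³ (*-assoc 2 o (b * b * b))))
  ...   | inj₁ 2∣o = contradiction 2∣o 2∤o
  ...   | inj₂ 2∣b³ with 2∣cube⇒2∣ b 2∣b³
  ...     | divides p refl =
    m , p , refl , *-cancelˡ-≡ _ _ 8 (trans (sym (cube-double m)) (trans a³≡2ob³ (double-odd-cube-double o p)))

  -- The 2-adic valuation of a³ is ≡ 0 (mod 3), that of 2 o b³ is ≡ 1 (mod 3).
  cube≢2*odd*cube : ∀ {o} → ¬ 2 ∣ o → ∀ a b → 0 < b → a * a * a ≢ 2 * o * (b * b * b)
  cube≢2*odd*cube {o} 2∤o a b = descent (<-wellFounded b) a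
    where
      descent : ∀ {b} → Acc _<_ b → ∀ a → 0 < b → a * a * a ≢ 2 * o * (b * b * b)
      descent {b} (acc smaller) a 0<b a³≡2ob³ with halving 2∤o a b a³≡2ob³
      ... | m , zero , refl , _ = contradiction 0<b (<-irrefl refl)
      ... | m , p@(suc _) , refl , m³≡2op³ = descent (smaller (m<m*n p 2 (s≤s (s≤s z≤n)))) m z<s m³≡2op³

module RationalSpace where
  open import Relation.Nullary.Decidable using (dec⇒maybe; decidable-stable)
  open import Data.Nat as ℕ using (ℕ; zero; suc)
  import Data.Nat.Properties as ℕ
  import Data.Nat.Divisibility as ℕ
  import Data.Nat.Tactic.RingSolver as ℕ-Solver
  open import Data.Integer as ℤ using (ℤ; +_; -[1+_]; +[1+_])
  import Data.Integer.Properties as ℤ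
  import Data.Integer.Divisibility.Signed as ℤˢ
  open import Data.Integer.DivMod using (_/ℕ_; _%ℕ_; a≡a%ℕn+[a/ℕn]*n; n%ℕd<d)
  import Data.Integer.Tactic.RingSolver as ℤ-Solver
  open import Data.Rational
  open import Data.Rational.Properties
  open import Data.Rational.Literals using (fromℤ)
  import Data.Rational.Unnormalised as ℚᵘ
  import Data.Rational.Unnormalised.Properties as ℚᵘ
  import Tactic.RingSolver.Core.AlmostCommutativeRing as ACR
  open import Tactic.RingSolver using (solve-∀)
  open import Data.Product using (∃; proj₁; proj₂)
  open import Data.Sum using (inj₁; inj₂; [_,_]′)
  open import Function.Bundles using (_⇔_; mk⇔; Equivalence)
  open import Function.Properties.Equivalence using (⇔-isEquivalence)
  open import Relation.Binary.Structures using (IsEquivalence)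
  open import Relation.Nullary using (¬_; yes; no; contradiction)
  open import Relation.Binary.PropositionalEquality
    using (_≡_; _≢_; refl; sym; trans; cong; cong₂; subst; subst₂; module ≡-Reasoning)
  open Countability using (countable-ℕ; countable-×; countable-surjection)
  open PerfectSpaces using (CountablePerfectSpace)
  open CubeRoots using (cube≢2*odd*cube)

  ℚ-ring : ACR.AlmostCommutativeRing 0ℓ 0ℓ
  ℚ-ring = ACR.fromCommutativeRing +-*-commutativeRing λ p → dec⇒maybe (0ℚ ≟ p)

  fromℤ-+ : ∀ a b → fromℤ (a ℤ.+ b) ≡ fromℤ a + fromℤ b
  fromℤ-+ a b =
    toℚᵘ-injective (ℚᵘ.≃-sym (ℚᵘ.≃-trans (toℚᵘ-homo-+ (fromℤ a) (fromℤ b)) (ℚᵘ.*≡* (eq a b))))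
    where
      eq : ∀ a b → (a ℤ.* + 1 ℤ.+ b ℤ.* + 1) ℤ.* + 1 ≡ (a ℤ.+ b) ℤ.* (+ 1 ℤ.* + 1)
      eq = ℤ-Solver.solve-∀

  fromℤ-* : ∀ a b → fromℤ (a ℤ.* b) ≡ fromℤ a * fromℤ b
  fromℤ-* a b = toℚᵘ-injective (ℚᵘ.≃-sym (ℚᵘ.≃-trans (toℚᵘ-homo-* (fromℤ a) (fromℤ b)) (ℚᵘ.*≡* refl)))

  fromℤ-neg : ∀ a → fromℤ (ℤ.- a) ≡ - fromℤ a
  fromℤ-neg (+ zero) = refl
  fromℤ-neg +[1+ n ] = refl
  fromℤ-neg -[1+ n ] = refl

  fromℤ-sub : ∀ a b → fromℤ (a ℤ.- b) ≡ fromℤ a - fromℤ b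
  fromℤ-sub a b = trans (fromℤ-+ a (ℤ.- b)) (cong (λ q → fromℤ a + q) (fromℤ-neg b))

  fromℤ-mono-≤ : ∀ {a b} → a ℤ.≤ b → fromℤ a ≤ fromℤ b
  fromℤ-mono-≤ {a} {b} a≤b = *≤* (subst₂ ℤ._≤_ (sym (ℤ.*-identityʳ a)) (sym (ℤ.*-identityʳ b)) a≤b)

  fromℤ-mono-< : ∀ {a b} → a ℤ.< b → fromℤ a < fromℤ b
  fromℤ-mono-< {a} {b} a<b = *<* (subst₂ ℤ._<_ (sym (ℤ.*-identityʳ a)) (sym (ℤ.*-identityʳ b)) a<b)

  *-denominator : ∀ x → x * fromℤ (↧ x) ≡ fromℤ (↥ x)
  *-denominator x@(mkℚ n d-1 _) =
    toℚᵘ-injective (ℚᵘ.≃-trans (toℚᵘ-homo-* x (fromℤ (↧ x))) (ℚᵘ.*≡* (eq n (+ suc d-1))))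
    where
      eq : ∀ n d → (n ℤ.* d) ℤ.* + 1 ≡ n ℤ.* (d ℤ.* + 1)
      eq = ℤ-Solver.solve-∀

  1≤∣fromℤ∣ : ∀ {z} → z ≢ + 0 → 1ℚ ≤ ∣ fromℤ z ∣
  1≤∣fromℤ∣ z≢0 = fromℤ-mono-≤ (ℤ.+≤+ (ℕ.n≢0⇒n>0 (λ ∣z∣≡0 → z≢0 (ℤ.∣i∣≡0⇒i≡0 ∣z∣≡0))))

  private
    0<1 : 0ℚ < 1ℚ
    0<1 = *<* (ℤ.+<+ ℕ.z<s)

    0≤1 : 0ℚ ≤ 1ℚ
    0≤1 = <⇒≤ 0<1

    *-monoˡ-≤-≥0 : ∀ r {p q} → 0ℚ ≤ r → p ≤ q → r * p ≤ r * q
    *-monoˡ-≤-≥0 r 0≤r = *-monoˡ-≤-nonNeg r {{nonNegative 0≤r}}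

    *-monoʳ-≤-≥0 : ∀ r {p q} → 0ℚ ≤ r → p ≤ q → p * r ≤ q * r
    *-monoʳ-≤-≥0 r 0≤r = *-monoʳ-≤-nonNeg r {{nonNegative 0≤r}}

    *-nonneg : ∀ {p q} → 0ℚ ≤ p → 0ℚ ≤ q → 0ℚ ≤ p * q
    *-nonneg {p} {q} 0≤p 0≤q = subst (_≤ p * q) (*-zeroˡ q) (*-monoʳ-≤-≥0 q 0≤q 0≤p)

    +-nonneg : ∀ {p q} → 0ℚ ≤ p → 0ℚ ≤ q → 0ℚ ≤ p + q
    +-nonneg {p} {q} 0≤p 0≤q = subst (_≤ p + q) (+-identityʳ 0ℚ) (+-mono-≤ 0≤p 0≤q)

    p≤q+p : ∀ p {q} → 0ℚ ≤ q → p ≤ q + p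
    p≤q+p p {q} 0≤q = subst (_≤ q + p) (+-identityˡ p) (+-monoˡ-≤ p 0≤q)

    p≤p+q : ∀ p {q} → 0ℚ ≤ q → p ≤ p + q
    p≤p+q p {q} 0≤q = subst (_≤ p + q) (+-identityʳ p) (+-monoʳ-≤ p 0≤q)

    *-pos : ∀ {p q} → 0ℚ < p → 0ℚ < q → 0ℚ < p * q
    *-pos {p} {q} 0<p 0<q = subst (_< p * q) (*-zeroˡ q) (*-monoˡ-<-pos q {{positive 0<q}} 0<p)

    square-mono : ∀ {a b} → 0ℚ ≤ a → a ≤ b → a * a ≤ b * b
    square-mono {a} {b} 0≤a a≤b = ≤-trans (*-monoʳ-≤-≥0 a 0≤a a≤b) (*-monoˡ-≤-≥0 b (≤-trans 0≤a a≤b) a≤b)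

    ∣scale-sub∣ : ∀ s a b → 0ℚ ≤ s → ∣ s * a - s * b ∣ ≡ s * ∣ a - b ∣
    ∣scale-sub∣ s a b 0≤s = trans (cong ∣_∣ (factor s a b))
      (trans (∣p*q∣≡∣p∣*∣q∣ s (a - b)) (cong (_* ∣ a - b ∣) (0≤p⇒∣p∣≡p 0≤s)))
      where
        factor : ∀ s a b → s * a - s * b ≡ s * (a - b)
        factor = solve-∀ ℚ-ring

    p≤q⇒0≤q-p : ∀ {p q} → p ≤ q → 0ℚ ≤ q - p
    p≤q⇒0≤q-p {p} {q} p≤q = subst (_≤ q - p) (+-inverseʳ p) (+-monoˡ-≤ (- p) p≤q)

    ⊓-pos : ∀ {p q} → 0ℚ < p → 0ℚ < q → 0ℚ < p ⊓ q
    ⊓-pos {p} {q} 0<p 0<q with ⊓-sel p q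
    ... | inj₁ p⊓q≡p = subst (0ℚ <_) (sym p⊓q≡p) 0<p
    ... | inj₂ p⊓q≡q = subst (0ℚ <_) (sym p⊓q≡q) 0<q

  p≤∣p∣ : ∀ p → p ≤ ∣ p ∣
  p≤∣p∣ p with ≤-total 0ℚ p
  ... | inj₁ 0≤p = ≤-reflexive (sym (0≤p⇒∣p∣≡p 0≤p))
  ... | inj₂ p≤0 = ≤-trans p≤0 (0≤∣p∣ p)

  square-nonneg : ∀ p → 0ℚ ≤ p * p
  square-nonneg p with ∣p∣≡p∨∣p∣≡-p p
  ... | inj₁ ∣p∣≡p = subst (λ q → 0ℚ ≤ q * q) ∣p∣≡p (*-nonneg (0≤∣p∣ p) (0≤∣p∣ p))
  ... | inj₂ ∣p∣≡-p =
    subst (0ℚ ≤_) (neg-square p) (subst (λ q → 0ℚ ≤ q * q) ∣p∣≡-p (*-nonneg (0≤∣p∣ p) (0≤∣p∣ p)))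
    where
      neg-square : ∀ p → - p * - p ≡ p * p
      neg-square = solve-∀ ℚ-ring

  square-abs : ∀ p → ∣ p ∣ * ∣ p ∣ ≡ p * p
  square-abs p = trans (sym (∣p*q∣≡∣p∣*∣q∣ p p)) (0≤p⇒∣p∣≡p (square-nonneg p))

  ∣-∣-comm : ∀ p q → ∣ p - q ∣ ≡ ∣ q - p ∣
  ∣-∣-comm p q = trans (sym (∣-p∣≡∣p∣ (p - q))) (cong ∣_∣ (neg-sub p q))
    where
      neg-sub : ∀ p q → - (p - q) ≡ q - p
      neg-sub = solve-∀ ℚ-ring

  small-reciprocal : ∀ X → 0ℚ ≤ X → ∃ λ δ → 0ℚ < δ × δ ≤ 1ℚ × δ * X ≤ 1ℚ
  small-reciprocal X 0≤X = δ , positive⁻¹ δ {{1/pos⇒pos Y}} , δ≤1 , δX≤1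
    where
      Y = 1ℚ + X
      instance
        Y-pos : Positive Y
        Y-pos = positive (<-≤-trans 0<1 (p≤p+q 1ℚ 0≤X))
      δ = (1/ Y) {{pos⇒nonZero Y}}
      0≤δ : 0ℚ ≤ δ
      0≤δ = <⇒≤ (positive⁻¹ δ {{1/pos⇒pos Y}})
      δY≡1 : δ * Y ≡ 1ℚ
      δY≡1 = *-inverseˡ Y {{pos⇒nonZero Y}}
      δ≤1 : δ ≤ 1ℚ
      δ≤1 = subst₂ _≤_ (*-identityʳ δ) δY≡1 (*-monoˡ-≤-≥0 δ 0≤δ (p≤p+q 1ℚ 0≤X))
      δX≤1 : δ * X ≤ 1ℚ
      δX≤1 = subst (δ * X ≤_) δY≡1 (*-monoˡ-≤-≥0 δ 0≤δ (subst (_≤ Y) (+-identityˡ X) (+-monoˡ-≤ X 0≤1)))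

  4ℚ : ℚ
  4ℚ = fromℤ (+ 4)

  cube : ℚ → ℚ
  cube x = x * x * x

  fromℤ-*-cube : ∀ a n → fromℤ (a ℤ.* (n ℤ.* n ℤ.* n)) ≡ fromℤ a * cube (fromℤ n)
  fromℤ-*-cube a n = trans (fromℤ-* a (n ℤ.* n ℤ.* n))
                       (cong (fromℤ a *_) (trans (fromℤ-* (n ℤ.* n) n) (cong (_* fromℤ n) (fromℤ-* n n))))

  cube-nonneg : ∀ {x} → 0ℚ ≤ x → 0ℚ ≤ cube x
  cube-nonneg 0≤x = *-nonneg (*-nonneg 0≤x 0≤x) 0≤x

  cube-pos : ∀ {x} → 0ℚ < x → 0ℚ < cube x
  cube-pos 0<x = *-pos (*-pos 0<x 0<x) 0<x

  cube-mono-≤ : ∀ {a b} → 0ℚ ≤ a → a ≤ b → cube a ≤ cube b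
  cube-mono-≤ {a} {b} 0≤a a≤b = ≤-trans (*-monoʳ-≤-≥0 a 0≤a (square-mono 0≤a a≤b))
                                        (*-monoˡ-≤-≥0 (b * b) (square-nonneg b) a≤b)

  -- x³ - y³ = (x - y) Q(x, y) with 4 Q(x, y) = (x - y)² + 3 (x + y)².
  private
    Q : ℚ → ℚ → ℚ
    Q x y = x * x + x * y + y * y

    cube-sub : ∀ x y → x * x * x - y * y * y ≡ (x - y) * (x * x + x * y + y * y)
    cube-sub = solve-∀ ℚ-ring

    -- The reflective solver only reads constants built from 1ℚ.
    4Q : ∀ x y → (1ℚ + 1ℚ + 1ℚ + 1ℚ) * (x * x + x * y + y * y)
               ≡ (x - y) * (x - y) + (1ℚ + 1ℚ + 1ℚ) * ((x + y) * (x + y))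
    4Q = solve-∀ ℚ-ring

    sub-square≤4Q : ∀ x y → (x - y) * (x - y) ≤ 4ℚ * Q x y
    sub-square≤4Q x y = subst ((x - y) * (x - y) ≤_) (sym (4Q x y))
      (p≤p+q _ (*-nonneg (fromℤ-mono-≤ (ℤ.+≤+ ℕ.z≤n)) (square-nonneg (x + y))))

    Q-nonneg : ∀ x y → 0ℚ ≤ Q x y
    Q-nonneg x y = *-cancelˡ-≤-pos 4ℚ (subst (_≤ 4ℚ * Q x y) (sym (*-zeroʳ 4ℚ))
                     (≤-trans (square-nonneg (x - y)) (sub-square≤4Q x y)))

    ∣cube-sub∣ : ∀ x y → ∣ cube x - cube y ∣ ≡ ∣ x - y ∣ * Q x y
    ∣cube-sub∣ x y = trans (cong ∣_∣ (cube-sub x y))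
                      (trans (∣p*q∣≡∣p∣*∣q∣ (x - y) (Q x y)) (cong (∣ x - y ∣ *_) (0≤p⇒∣p∣≡p (Q-nonneg x y))))

    Q≤square-sum : ∀ x y → Q x y ≤ (∣ x ∣ + ∣ y ∣) * (∣ x ∣ + ∣ y ∣)
    Q≤square-sum x y = begin
      Q x y                                                      ≤⟨ p≤∣p∣ (Q x y) ⟩
      ∣ Q x y ∣                                                  ≤⟨ ∣p+q∣≤∣p∣+∣q∣ (x * x + x * y) (y * y) ⟩
      ∣ x * x + x * y ∣ + ∣ y * y ∣                              ≤⟨ +-monoˡ-≤ ∣ y * y ∣ (∣p+q∣≤∣p∣+∣q∣ (x * x) (x * y)) ⟩
      ∣ x * x ∣ + ∣ x * y ∣ + ∣ y * y ∣                          ≡⟨ cong₂ _+_ (cong₂ _+_ (∣p*q∣≡∣p∣*∣q∣ x x) (∣p*q∣≡∣p∣*∣q∣ x y))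
                                                                             (∣p*q∣≡∣p∣*∣q∣ y y) ⟩
      ∣ x ∣ * ∣ x ∣ + ∣ x ∣ * ∣ y ∣ + ∣ y ∣ * ∣ y ∣              ≤⟨ p≤p+q _ (*-nonneg (0≤∣p∣ x) (0≤∣p∣ y)) ⟩
      ∣ x ∣ * ∣ x ∣ + ∣ x ∣ * ∣ y ∣ + ∣ y ∣ * ∣ y ∣ + ∣ x ∣ * ∣ y ∣  ≡⟨ square-sum ∣ x ∣ ∣ y ∣ ⟩
      (∣ x ∣ + ∣ y ∣) * (∣ x ∣ + ∣ y ∣)                          ∎
      where
        open ≤-Reasoning
        square-sum : ∀ a b → a * a + a * b + b * b + a * b ≡ (a + b) * (a + b)
        square-sum = solve-∀ ℚ-ring

  cube-dist-lower : ∀ x y → ∣ x - y ∣ * ∣ x - y ∣ * ∣ x - y ∣ ≤ 4ℚ * ∣ cube x - cube y ∣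
  cube-dist-lower x y = begin
    d * d * d                  ≡⟨ *-assoc d d d ⟩
    d * (d * d)                ≡⟨ cong (d *_) (square-abs (x - y)) ⟩
    d * ((x - y) * (x - y))    ≤⟨ *-monoˡ-≤-≥0 d (0≤∣p∣ _) (sub-square≤4Q x y) ⟩
    d * (4ℚ * Q x y)           ≡⟨ *-swap d 4ℚ (Q x y) ⟩
    4ℚ * (d * Q x y)           ≡⟨ cong (4ℚ *_) (sym (∣cube-sub∣ x y)) ⟩
    4ℚ * ∣ cube x - cube y ∣   ∎
    where
      open ≤-Reasoning
      d = ∣ x - y ∣
      *-swap : ∀ a b c → a * (b * c) ≡ b * (a * c)
      *-swap = solve-∀ ℚ-ring

  cube-dist-upper : ∀ x y → ∣ cube x - cube y ∣ ≤ ∣ x - y ∣ * ((∣ x ∣ + ∣ y ∣) * (∣ x ∣ + ∣ y ∣))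
  cube-dist-upper x y = subst (_≤ ∣ x - y ∣ * ((∣ x ∣ + ∣ y ∣) * (∣ x ∣ + ∣ y ∣))) (sym (∣cube-sub∣ x y))
                          (*-monoˡ-≤-≥0 ∣ x - y ∣ (0≤∣p∣ _) (Q≤square-sum x y))

  lip : ℚ → ℚ
  lip x = (∣ x ∣ + (∣ x ∣ + 1ℚ)) * (∣ x ∣ + (∣ x ∣ + 1ℚ))

  lip-pos : ∀ x → 0ℚ < lip x
  lip-pos x = *-pos 0<2∣x∣+1 0<2∣x∣+1
    where
      0<2∣x∣+1 : 0ℚ < ∣ x ∣ + (∣ x ∣ + 1ℚ)
      0<2∣x∣+1 = <-≤-trans 0<1 (≤-trans (p≤q+p 1ℚ (0≤∣p∣ x)) (p≤q+p _ (0≤∣p∣ x)))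

  cube-lipschitz : ∀ x y → ∣ x - y ∣ ≤ 1ℚ → ∣ cube x - cube y ∣ ≤ ∣ x - y ∣ * lip x
  cube-lipschitz x y x-y≤1 = ≤-trans (cube-dist-upper x y) (*-monoˡ-≤-≥0 ∣ x - y ∣ (0≤∣p∣ _)
    (square-mono (+-nonneg (0≤∣p∣ x) (0≤∣p∣ y)) (+-monoʳ-≤ ∣ x ∣ ∣y∣≤∣x∣+1)))
    where
      sub-sub : ∀ a b → a - (a - b) ≡ b
      sub-sub = solve-∀ ℚ-ring
      ∣y∣≤∣x∣+1 : ∣ y ∣ ≤ ∣ x ∣ + 1ℚ
      ∣y∣≤∣x∣+1 = ≤-trans (subst (λ e → ∣ e ∣ ≤ ∣ x ∣ + ∣ x - y ∣) (sub-sub x y)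
                                 (∣p-q∣≤∣p∣+∣q∣ x (x - y)))
                          (+-monoʳ-≤ ∣ x ∣ x-y≤1)

  8^_ : ℕ → ℚ
  8^ i = fromℤ (+ (8 ℕ.^ i))

  8^-mono-≤ : ∀ {i k} → i ℕ.≤ k → 8^ i ≤ 8^ k
  8^-mono-≤ i≤k = fromℤ-mono-≤ (ℤ.+≤+ (ℕ.^-monoʳ-≤ 8 i≤k))

  8^-pos : ∀ i → 0ℚ < 8^ i
  8^-pos i = fromℤ-mono-< (ℤ.+<+ (ℕ.m^n>0 8 i))

  n≤8^n : ∀ n → n ℕ.≤ 8 ℕ.^ n
  n≤8^n zero = ℕ.z≤n
  n≤8^n (suc n) = ℕ.+-mono-≤ (ℕ.m^n>0 8 n) (ℕ.≤-trans (n≤8^n n) (ℕ.m≤n*m (8 ℕ.^ n) 7))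

  -- The cut values 2 (2j + 1) are twice an odd number, so they are never of the
  -- form 8ⁱ x³ with x rational.
  cutℤ : ℤ → ℤ
  cutℤ j = + 2 ℤ.* (+ 2 ℤ.* j ℤ.+ + 1)

  cut : ℤ → ℚ
  cut j = fromℤ (cutℤ j)

  private
    ∣2j+1∣-odd : ∀ j → ¬ 2 ℕ.∣ ℤ.∣ + 2 ℤ.* j ℤ.+ + 1 ∣
    ∣2j+1∣-odd j 2∣
      with ℕ.∣1⇒≡1 (ℤˢ.∣⇒∣ᵤ (ℤˢ.∣m+n∣m⇒∣n (ℤˢ.∣ᵤ⇒∣ 2∣) (ℤˢ.∣m⇒∣m*n j (ℤˢ.∣-refl {+ 2}))))
    ... | ()

    ∣cube∣ : ∀ n → ℤ.∣ n ℤ.* n ℤ.* n ∣ ≡ ℤ.∣ n ∣ ℕ.* ℤ.∣ n ∣ ℕ.* ℤ.∣ n ∣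
    ∣cube∣ n = trans (ℤ.abs-* (n ℤ.* n) n) (cong (ℕ._* ℤ.∣ n ∣) (ℤ.abs-* n n))

    8^≡cube-2^ : ∀ i → 8 ℕ.^ i ≡ 2 ℕ.^ i ℕ.* 2 ℕ.^ i ℕ.* 2 ℕ.^ i
    8^≡cube-2^ zero = refl
    8^≡cube-2^ (suc i) = trans (cong (8 ℕ.*_) (8^≡cube-2^ i)) (eight-cubes (2 ℕ.^ i))
      where
        eight-cubes : ∀ a → 8 ℕ.* (a ℕ.* a ℕ.* a) ≡ 2 ℕ.* a ℕ.* (2 ℕ.* a) ℕ.* (2 ℕ.* a)
        eight-cubes = ℕ-Solver.solve-∀

    cube-* : ∀ a b → a ℕ.* b ℕ.* (a ℕ.* b) ℕ.* (a ℕ.* b) ≡ a ℕ.* a ℕ.* a ℕ.* (b ℕ.* b ℕ.* b)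
    cube-* = ℕ-Solver.solve-∀

  scaled-cube≢cut : ∀ i n j d → 0 ℕ.< d →
                    + (8 ℕ.^ i) ℤ.* (n ℤ.* n ℤ.* n) ≢ cutℤ j ℤ.* (+ d ℤ.* + d ℤ.* + d)
  scaled-cube≢cut i n j d 0<d eq = cube≢2*odd*cube (∣2j+1∣-odd j) a d 0<d (begin
    a ℕ.* a ℕ.* a                                          ≡⟨ cube-* (2 ℕ.^ i) ℤ.∣ n ∣ ⟩
    2ⁱ ℕ.* 2ⁱ ℕ.* 2ⁱ ℕ.* (ℤ.∣ n ∣ ℕ.* ℤ.∣ n ∣ ℕ.* ℤ.∣ n ∣)  ≡⟨ cong₂ ℕ._*_ (8^≡cube-2^ i) (∣cube∣ n) ⟨
    8 ℕ.^ i ℕ.* ℤ.∣ n ℤ.* n ℤ.* n ∣                         ≡⟨ ℤ.abs-* (+ (8 ℕ.^ i)) (n ℤ.* n ℤ.* n) ⟨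
    ℤ.∣ + (8 ℕ.^ i) ℤ.* (n ℤ.* n ℤ.* n) ∣                   ≡⟨ cong ℤ.∣_∣ eq ⟩
    ℤ.∣ cutℤ j ℤ.* (+ d ℤ.* + d ℤ.* + d) ∣                  ≡⟨ ℤ.abs-* (cutℤ j) (+ d ℤ.* + d ℤ.* + d) ⟩
    ℤ.∣ cutℤ j ∣ ℕ.* ℤ.∣ + d ℤ.* + d ℤ.* + d ∣              ≡⟨ cong₂ ℕ._*_ (ℤ.abs-* (+ 2) (+ 2 ℤ.* j ℤ.+ + 1)) (∣cube∣ (+ d)) ⟩
    2 ℕ.* ℤ.∣ + 2 ℤ.* j ℤ.+ + 1 ∣ ℕ.* (d ℕ.* d ℕ.* d)       ∎)
    where
      open ≡-Reasoning
      2ⁱ = 2 ℕ.^ i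
      a = 2ⁱ ℕ.* ℤ.∣ n ∣

  -- For x = n / d, (8ⁱ x³ - cut j) d³ is a nonzero integer.
  cut-gap : ∀ i j x → 1ℚ ≤ ∣ 8^ i * cube x - cut j ∣ * cube (fromℤ (↧ x))
  cut-gap i j x = begin
    1ℚ                                             ≤⟨ 1≤∣fromℤ∣ z≢0 ⟩
    ∣ fromℤ z ∣                                    ≡⟨ cong ∣_∣ fromℤ-z ⟩
    ∣ (8^ i * cube x - cut j) * cube D ∣           ≡⟨ ∣p*q∣≡∣p∣*∣q∣ (8^ i * cube x - cut j) (cube D) ⟩
    ∣ 8^ i * cube x - cut j ∣ * ∣ cube D ∣         ≡⟨ cong (∣ 8^ i * cube x - cut j ∣ *_) (0≤p⇒∣p∣≡p 0≤D³) ⟩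
    ∣ 8^ i * cube x - cut j ∣ * cube D             ∎
    where
      open ≤-Reasoning
      n = ↥ x
      d = ↧ x
      D = fromℤ d
      z = + (8 ℕ.^ i) ℤ.* (n ℤ.* n ℤ.* n) ℤ.- cutℤ j ℤ.* (d ℤ.* d ℤ.* d)
      z≢0 : z ≢ + 0
      z≢0 z≡0 = scaled-cube≢cut i n j (↧ₙ x) ℕ.z<s (ℤ.i-j≡0⇒i≡j _ _ z≡0)
      0≤D³ : 0ℚ ≤ cube D
      0≤D³ = cube-nonneg (fromℤ-mono-≤ {+ 0} {d} (ℤ.+≤+ ℕ.z≤n))
      rearrange : ∀ e c x D → e * ((x * D) * (x * D) * (x * D)) - c * (D * D * D) ≡ (e * (x * x * x) - c) * (D * D * D)
      rearrange = solve-∀ ℚ-ring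
      fromℤ-z : fromℤ z ≡ (8^ i * cube x - cut j) * cube D
      fromℤ-z = begin-equality
        fromℤ z                                  ≡⟨ fromℤ-sub (+ (8 ℕ.^ i) ℤ.* (n ℤ.* n ℤ.* n)) (cutℤ j ℤ.* (d ℤ.* d ℤ.* d)) ⟩
        _                                        ≡⟨ cong₂ _-_ (fromℤ-*-cube (+ (8 ℕ.^ i)) n) (fromℤ-*-cube (cutℤ j) d) ⟩
        8^ i * cube (fromℤ n) - cut j * cube D   ≡⟨ cong (λ y → 8^ i * cube y - cut j * cube D) (*-denominator x) ⟨
        8^ i * cube (x * D) - cut j * cube D     ≡⟨ rearrange (8^ i) (cut j) x D ⟩
        (8^ i * cube x - cut j) * cube D         ∎

  -- Consecutive cuts are 4 apart; the cut above A is found by dividing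
  -- ↥ A + 2 ↧ A by 4 ↧ A.
  cut-between : ∀ A → ∃ λ j → A < cut j × cut j ≤ A + 4ℚ
  cut-between A@(mkℚ n d-1 _) = q , A<cut , cut≤A+4
    where
      d = suc d-1
      D = + d
      q = (n ℤ.+ + 2 ℤ.* D) /ℕ (4 ℕ.* d)
      r = (n ℤ.+ + 2 ℤ.* D) %ℕ (4 ℕ.* d)
      X = q ℤ.* (+ 4 ℤ.* D) ℤ.- + 2 ℤ.* D
      division : n ℤ.+ + 2 ℤ.* D ≡ + r ℤ.+ q ℤ.* (+ 4 ℤ.* D)
      division = trans (a≡a%ℕn+[a/ℕn]*n (n ℤ.+ + 2 ℤ.* D) (4 ℕ.* d)) (cong (λ m → + r ℤ.+ q ℤ.* m) (ℤ.pos-* 4 d))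
      n≡r+X : n ℤ.* + 1 ≡ + r ℤ.+ X
      n≡r+X = trans (shift n D) (trans (cong (ℤ._- + 2 ℤ.* D) division) (regroup (+ r) q D))
        where
          shift : ∀ n D → n ℤ.* + 1 ≡ (n ℤ.+ + 2 ℤ.* D) ℤ.- + 2 ℤ.* D
          shift = ℤ-Solver.solve-∀
          regroup : ∀ r q D → r ℤ.+ q ℤ.* (+ 4 ℤ.* D) ℤ.- + 2 ℤ.* D ≡ r ℤ.+ (q ℤ.* (+ 4 ℤ.* D) ℤ.- + 2 ℤ.* D)
          regroup = ℤ-Solver.solve-∀
      cut-q : ∀ q D → (+ 2 ℤ.* (+ 2 ℤ.* q ℤ.+ + 1)) ℤ.* D ≡ + 4 ℤ.* D ℤ.+ (q ℤ.* (+ 4 ℤ.* D) ℤ.- + 2 ℤ.* D)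
      cut-q = ℤ-Solver.solve-∀
      cut-q-4 : ∀ q D → (+ 2 ℤ.* (+ 2 ℤ.* q ℤ.+ + 1) ℤ.- + 4) ℤ.* D ≡ + 0 ℤ.+ (q ℤ.* (+ 4 ℤ.* D) ℤ.- + 2 ℤ.* D)
      cut-q-4 = ℤ-Solver.solve-∀
      r<4D : + r ℤ.< + 4 ℤ.* D
      r<4D = subst (+ r ℤ.<_) (ℤ.pos-* 4 d) (ℤ.+<+ (n%ℕd<d (n ℤ.+ + 2 ℤ.* D) (4 ℕ.* d)))
      A<cut : A < cut q
      A<cut = *<* (subst₂ ℤ._<_ (sym n≡r+X) (sym (cut-q q D)) (ℤ.+-monoˡ-< X r<4D))
      cut-4≤A : fromℤ (cutℤ q ℤ.- + 4) ≤ A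
      cut-4≤A = *≤* (subst₂ ℤ._≤_ (sym (cut-q-4 q D)) (sym n≡r+X) (ℤ.+-monoˡ-≤ X (ℤ.+≤+ ℕ.z≤n)))
      cut≤A+4 : cut q ≤ A + 4ℚ
      cut≤A+4 = subst (_≤ A + 4ℚ) (trans (sym (fromℤ-+ (cutℤ q ℤ.- + 4) (+ 4))) (cong fromℤ (cancel-4 (cutℤ q))))
                  (+-monoˡ-≤ 4ℚ cut-4≤A)
        where
          cancel-4 : ∀ c → c ℤ.- + 4 ℤ.+ + 4 ≡ c
          cancel-4 = ℤ-Solver.solve-∀

  cut-under : ∀ {A A′} → A′ + 4ℚ ≤ A → ∃ λ j → A′ < cut j × ¬ A < cut j
  cut-under {A} {A′} A′+4≤A =
    let j , A′<cut , cut≤A′+4 = cut-between A′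
    in  j , A′<cut , λ A<cut → <-irrefl refl (<-≤-trans A<cut (≤-trans cut≤A′+4 A′+4≤A))

  same-side : ∀ {A A′ c} → ∣ A - A′ ∣ < ∣ A - c ∣ → A < c ⇔ A′ < c
  same-side {A} {A′} {c} close with A <? c
  ... | yes A<c = mk⇔ (λ _ → A′<c) (λ _ → A<c)
    where
      open ≤-Reasoning
      A′<c : A′ < c
      A′<c = begin-strict
        A′                  ≡⟨ sym (add-sub A A′) ⟩
        A + (A′ - A)        ≤⟨ +-monoʳ-≤ A (≤-trans (p≤∣p∣ (A′ - A)) (≤-reflexive (∣-∣-comm A′ A))) ⟩
        A + ∣ A - A′ ∣      <⟨ +-monoʳ-< A close ⟩
        A + ∣ A - c ∣       ≡⟨ cong (λ e → A + e) (trans (∣-∣-comm A c) (0≤p⇒∣p∣≡p (p≤q⇒0≤q-p (<⇒≤ A<c)))) ⟩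
        A + (c - A)         ≡⟨ add-sub A c ⟩
        c                   ∎
        where
          add-sub : ∀ a b → a + (b - a) ≡ b
          add-sub = solve-∀ ℚ-ring
  ... | no A≮c = mk⇔ (λ A<c → contradiction A<c A≮c) (λ A′<c → contradiction A′<c (<-asym c<A′))
    where
      open ≤-Reasoning
      c≤A : c ≤ A
      c≤A = ≮⇒≥ A≮c
      c<A′ : c < A′
      c<A′ = begin-strict
        c                   ≡⟨ sym (sub-sub A c) ⟩
        A - (A - c)         ≡⟨ cong (λ e → A - e) (sym (0≤p⇒∣p∣≡p (p≤q⇒0≤q-p c≤A))) ⟩
        A - ∣ A - c ∣       <⟨ +-monoʳ-< A (neg-antimono-< close) ⟩
        A - ∣ A - A′ ∣      ≤⟨ +-monoʳ-≤ A (neg-antimono-≤ (p≤∣p∣ (A - A′))) ⟩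
        A - (A - A′)        ≡⟨ sub-sub A A′ ⟩
        A′                  ∎
        where
          sub-sub : ∀ a b → a - (a - b) ≡ b
          sub-sub = solve-∀ ℚ-ring

  far-apart-separated : ∀ {A A′} → 4ℚ ≤ ∣ A - A′ ∣ → ∃ λ j → ¬ (A′ < cut j ⇔ A < cut j)
  far-apart-separated {A} {A′} 4≤∣A-A′∣ = [ A-above , A-below ]′ (∣p∣≡p∨∣p∣≡-p (A - A′))
    where
      add-sub : ∀ a b → a + (b - a) ≡ b
      add-sub = solve-∀ ℚ-ring
      add-neg-sub : ∀ a b → a + - (a - b) ≡ b
      add-neg-sub = solve-∀ ℚ-ring
      A-above : ∣ A - A′ ∣ ≡ A - A′ → ∃ λ j → ¬ (A′ < cut j ⇔ A < cut j)
      A-above ∣A-A′∣≡A-A′ =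
        let j , A′<cut , A≮cut = cut-under (subst (A′ + 4ℚ ≤_) (add-sub A′ A)
                                   (+-monoʳ-≤ A′ (subst (4ℚ ≤_) ∣A-A′∣≡A-A′ 4≤∣A-A′∣)))
        in  j , λ same → A≮cut (Equivalence.to same A′<cut)
      A-below : ∣ A - A′ ∣ ≡ - (A - A′) → ∃ λ j → ¬ (A′ < cut j ⇔ A < cut j)
      A-below ∣A-A′∣≡A′-A =
        let j , A<cut , A′≮cut = cut-under (subst (A + 4ℚ ≤_) (add-neg-sub A A′)
                                   (+-monoʳ-≤ A (subst (4ℚ ≤_) ∣A-A′∣≡A′-A 4≤∣A-A′∣)))
        in  j , λ same → A′≮cut (Equivalence.from same A<cut)

  archimedean : ∀ q → 0ℚ < q → ∀ n → ∃ λ k → fromℤ (+ n) ≤ 8^ k * q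
  archimedean q 0<q n = n ℕ.* d , (begin
    fromℤ (+ n)                          ≡⟨ sym (*-identityʳ _) ⟩
    fromℤ (+ n) * 1ℚ                     ≤⟨ *-monoˡ-≤-≥0 (fromℤ (+ n)) (fromℤ-mono-≤ (ℤ.+≤+ ℕ.z≤n)) (fromℤ-mono-≤ 1≤↥q) ⟩
    fromℤ (+ n) * fromℤ (↥ q)            ≡⟨ cong (fromℤ (+ n) *_) (sym (*-denominator q)) ⟩
    fromℤ (+ n) * (q * fromℤ (+ d))      ≡⟨ regroup (fromℤ (+ n)) q (fromℤ (+ d)) ⟩
    fromℤ (+ n) * fromℤ (+ d) * q        ≡⟨ cong (_* q) (trans (sym (fromℤ-* (+ n) (+ d))) (cong fromℤ (sym (ℤ.pos-* n d)))) ⟩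
    fromℤ (+ (n ℕ.* d)) * q              ≤⟨ *-monoʳ-≤-≥0 q (<⇒≤ 0<q) (fromℤ-mono-≤ (ℤ.+≤+ (n≤8^n (n ℕ.* d)))) ⟩
    8^ (n ℕ.* d) * q                     ∎)
    where
      open ≤-Reasoning
      d = ↧ₙ q
      1≤↥q : + 1 ℤ.≤ ↥ q
      1≤↥q = ℤ.i<j⇒suc[i]≤j (subst (+ 0 ℤ.<_) (ℤ.*-identityʳ (↥ q)) (drop-*<* 0<q))
      regroup : ∀ a q b → a * (q * b) ≡ a * b * q
      regroup = solve-∀ ℚ-ring

  Below : ℕ → ℤ → ℚ → Set
  Below i j x = 8^ i * cube x < cut j

  -- x ∼[ k ] y: no cut point ∛(cut j / 8ⁱ) with i ≤ k lies between x and y.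
  infix 4 _∼[_]_
  _∼[_]_ : ℚ → ℕ → ℚ → Set
  x ∼[ k ] y = ∀ {i} → i ℕ.≤ k → ∀ j → Below i j x ⇔ Below i j y

  private
    module ⇔ {ℓ} = IsEquivalence (⇔-isEquivalence {ℓ})

  sensitivity : ℚ → ℕ → ℚ
  sensitivity x k = 8^ k * lip x * cube (fromℤ (↧ x))

  sensitivity-pos : ∀ x k → 0ℚ < sensitivity x k
  sensitivity-pos x k = *-pos (*-pos (8^-pos k) (lip-pos x)) (cube-pos 0<d)
    where
      0<d : 0ℚ < fromℤ (↧ x)
      0<d = fromℤ-mono-< {+ 0} {↧ x} (ℤ.+<+ ℕ.z<s)

  ball⊆class-radius : ∀ x k {δ} → δ ≤ 1ℚ → δ * sensitivity x k ≤ 1ℚ →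
                      ∀ y → ∣ x - y ∣ < δ → y ∼[ k ] x
  ball⊆class-radius x k {δ} δ≤1 δS≤1 y x-y<δ {i} i≤k j = ⇔.sym (same-side closer)
    where
      open ≤-Reasoning
      D = cube (fromℤ (↧ x))
      0≤D : 0ℚ ≤ D
      0≤D = cube-nonneg (fromℤ-mono-≤ {+ 0} {↧ x} (ℤ.+≤+ ℕ.z≤n))
      A = 8^ i * cube x
      A′ = 8^ i * cube y
      closer : ∣ A - A′ ∣ < ∣ A - cut j ∣
      closer = *-cancelʳ-<-nonNeg D {{nonNegative 0≤D}} (begin-strict
        ∣ A - A′ ∣ * D                            ≡⟨ cong (_* D) (∣scale-sub∣ (8^ i) (cube x) (cube y) (<⇒≤ (8^-pos i))) ⟩
        8^ i * ∣ cube x - cube y ∣ * D            ≤⟨ *-monoʳ-≤-≥0 D 0≤D (*-monoʳ-≤-≥0 _ (0≤∣p∣ (cube x - cube y)) (8^-mono-≤ i≤k)) ⟩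
        8^ k * ∣ cube x - cube y ∣ * D            ≤⟨ *-monoʳ-≤-≥0 D 0≤D (*-monoˡ-≤-≥0 (8^ k) (<⇒≤ (8^-pos k))
                                                       (cube-lipschitz x y (<⇒≤ (<-≤-trans x-y<δ δ≤1)))) ⟩
        8^ k * (∣ x - y ∣ * lip x) * D            ≡⟨ regroup (8^ k) ∣ x - y ∣ (lip x) D ⟩
        ∣ x - y ∣ * sensitivity x k               <⟨ *-monoˡ-<-pos (sensitivity x k) {{positive (sensitivity-pos x k)}} x-y<δ ⟩
        δ * sensitivity x k                       ≤⟨ δS≤1 ⟩
        1ℚ                                        ≤⟨ cut-gap i j x ⟩
        ∣ A - cut j ∣ * D                         ∎)
        where
          regroup : ∀ e a l d → e * (a * l) * d ≡ a * (e * l * d)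
          regroup = solve-∀ ℚ-ring

  ball⊆class : ∀ x k → ∃ λ δ → 0ℚ < δ × ∀ y → ∣ x - y ∣ < δ → y ∼[ k ] x
  ball⊆class x k =
    let δ , 0<δ , δ≤1 , δS≤1 = small-reciprocal (sensitivity x k) (<⇒≤ (sensitivity-pos x k))
    in  δ , 0<δ , ball⊆class-radius x k δ≤1 δS≤1

  far⇒separated : ∀ {x y k ε} → fromℤ (+ 16) ≤ 8^ k * cube ε → 0ℚ ≤ ε → ε ≤ ∣ x - y ∣ → ¬ y ∼[ k ] x
  far⇒separated {x} {y} {k} {ε} 16≤8ᵏε³ 0≤ε ε≤∣x-y∣ y∼x =
    let j , separated = far-apart-separated 4≤∣A-A′∣ in separated (y∼x ℕ.≤-refl j)
    where
      A = 8^ k * cube x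
      A′ = 8^ k * cube y
      d = ∣ x - y ∣
      open ≤-Reasoning
      *-swap : ∀ a b c → a * (b * c) ≡ b * (a * c)
      *-swap = solve-∀ ℚ-ring
      4≤∣A-A′∣ : 4ℚ ≤ ∣ A - A′ ∣
      4≤∣A-A′∣ = *-cancelˡ-≤-pos 4ℚ (begin
        4ℚ * 4ℚ                          ≤⟨ 16≤8ᵏε³ ⟩
        8^ k * cube ε                    ≤⟨ *-monoˡ-≤-≥0 (8^ k) (<⇒≤ (8^-pos k)) (cube-mono-≤ 0≤ε ε≤∣x-y∣) ⟩
        8^ k * (d * d * d)               ≤⟨ *-monoˡ-≤-≥0 (8^ k) (<⇒≤ (8^-pos k)) (cube-dist-lower x y) ⟩
        8^ k * (4ℚ * ∣ cube x - cube y ∣) ≡⟨ *-swap (8^ k) 4ℚ ∣ cube x - cube y ∣ ⟩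
        4ℚ * (8^ k * ∣ cube x - cube y ∣) ≡⟨ cong (4ℚ *_) (sym (∣scale-sub∣ (8^ k) (cube x) (cube y) (<⇒≤ (8^-pos k)))) ⟩
        4ℚ * ∣ A - A′ ∣                  ∎)

  class⊆ball : ∀ x ε → 0ℚ < ε → ∃ λ k → ∀ y → y ∼[ k ] x → ∣ x - y ∣ < ε
  class⊆ball x ε 0<ε =
    let k , 16≤8ᵏε³ = archimedean (cube ε) (cube-pos 0<ε) 16
    in  k , λ y y∼x → decidable-stable (∣ x - y ∣ <? ε) λ far →
                        far⇒separated {x} {y} 16≤8ᵏε³ (<⇒≤ 0<ε) (≮⇒≥ far) y∼x

  ≢⇒0<∣-∣ : ∀ {x y} → x ≢ y → 0ℚ < ∣ x - y ∣
  ≢⇒0<∣-∣ {x} {y} x≢y = decidable-stable (0ℚ <? ∣ x - y ∣) λ ≮ →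
    x≢y (trans (sym (sub-add x y)) (trans (cong (_+ y) (x-y≡0 ≮)) (+-identityˡ y)))
    where
      sub-add : ∀ a b → a - b + b ≡ a
      sub-add = solve-∀ ℚ-ring
      x-y≡0 : ¬ 0ℚ < ∣ x - y ∣ → x - y ≡ 0ℚ
      x-y≡0 ≮ = ∣p∣≡0⇒p≡0 (x - y) (≤-antisym (≮⇒≥ ≮) (0≤∣p∣ (x - y)))

  ∼-all⇒≡ : ∀ {x y} → (∀ k → y ∼[ k ] x) → y ≡ x
  ∼-all⇒≡ {x} {y} y≋x = decidable-stable (y ≟ x) λ y≢x →
    let k , small = class⊆ball x ∣ x - y ∣ (≢⇒0<∣-∣ (λ x≡y → y≢x (sym x≡y)))
    in  <-irrefl refl (small y (y≋x k))

  perfect : ∀ x k → ∃ λ y → ¬ (∀ k → y ∼[ k ] x) × y ∼[ k ] x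
  perfect x k =
    let δ , 0<δ , ball = ball⊆class x k
        0<δ/2 : 0ℚ < δ * ½
        0<δ/2 = *-pos 0<δ 0<½
    in  x + δ * ½ , (λ x+δ/2≋x → <-irrefl (sym (shift-zero (∼-all⇒≡ x+δ/2≋x))) 0<δ/2)
                  , ball (x + δ * ½) (subst (_< δ) (sym (∣x-[x+h]∣ (<⇒≤ 0<δ/2))) (half< 0<δ))
    where
      0<½ : 0ℚ < ½
      0<½ = *<* (ℤ.+<+ ℕ.z<s)
      half< : ∀ {δ} → 0ℚ < δ → δ * ½ < δ
      half< {δ} 0<δ = subst (δ * ½ <_) (*-identityʳ δ)
                        (*-monoʳ-<-pos δ {{positive 0<δ}} (*<* (ℤ.+<+ (ℕ.s≤s (ℕ.s≤s ℕ.z≤n)))))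
      shift-zero : ∀ {h} → x + h ≡ x → h ≡ 0ℚ
      shift-zero {h} x+h≡x = trans (sym (cancel x h)) (trans (cong (_- x) x+h≡x) (+-inverseʳ x))
        where
          cancel : ∀ a b → a + b - a ≡ b
          cancel = solve-∀ ℚ-ring
      ∣x-[x+h]∣ : ∀ {h} → 0ℚ ≤ h → ∣ x - (x + h) ∣ ≡ h
      ∣x-[x+h]∣ {h} 0≤h = trans (cong ∣_∣ (sub-add-self x h)) (trans (∣-p∣≡∣p∣ h) (0≤p⇒∣p∣≡p 0≤h))
        where
          sub-add-self : ∀ a b → a - (a + b) ≡ - b
          sub-add-self = solve-∀ ℚ-ring

  countable-ℤ : Countable ℤ
  countable-ℤ = countable-surjection (countable-× countable-ℕ countable-ℕ) (λ (a , b) → + a ℤ.- + b) difference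
    where
      difference : ∀ z → ∃ λ ab → + proj₁ ab ℤ.- + proj₂ ab ≡ z
      difference (+ m) = (m , 0) , ℤ.+-identityʳ (+ m)
      difference -[1+ m ] = (0 , suc m) , refl

  countable-ℚ : Countable ℚ
  countable-ℚ = countable-surjection (countable-× countable-ℤ countable-ℕ) (λ (n , d-1) → n / suc d-1)
    λ p → (↥ p , ℚ.denominator-1 p) , ↥p/↧p≡p p

  ℚ-space : CountablePerfectSpace
  ℚ-space = record
    { Carrier = ℚ
    ; _∼[_]_ = _∼[_]_
    ; ∼-refl = λ _ _ → ⇔.refl
    ; ∼-sym = λ x∼y i≤k j → ⇔.sym (x∼y i≤k j)
    ; ∼-trans = λ x∼y y∼z i≤k j → ⇔.trans (x∼y i≤k j) (y∼z i≤k j)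
    ; ∼-pred = λ x∼y i≤k j → x∼y (ℕ.m≤n⇒m≤1+n i≤k) j
    ; countable = countable-ℚ
    ; perfect = perfect
    }

  continuous₂ : ∀ {_∙_} → CountablePerfectSpace.Continuous₂ᶠ ℚ-space _∙_ → Continuous₂ _∙_
  continuous₂ {_∙_} cont x y ε 0<ε =
    let k , small = class⊆ball (x ∙ y) ε 0<ε
        j , close = cont x y k
        δ₁ , 0<δ₁ , ball₁ = ball⊆class x j
        δ₂ , 0<δ₂ , ball₂ = ball⊆class y j
    in  δ₁ ⊓ δ₂ , ⊓-pos 0<δ₁ 0<δ₂ , λ x′ y′ x-x′<δ y-y′<δ →
          small (x′ ∙ y′) (close (ball₁ x′ (<-≤-trans x-x′<δ (p⊓q≤p δ₁ δ₂)))
                                 (ball₂ y′ (<-≤-trans y-y′<δ (p⊓q≤q δ₁ δ₂))))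

mainTheorem7 : ExcludedMiddle 0ℓ → (M : Structure) → IsModelIΔ₀Exp M → Countable (Structure.Carrier M) →
    Σ (ℚ → ℚ → ℚ) λ _⊕_ → Σ (ℚ → ℚ → ℚ) λ _⊗_ →
      Continuous₂ _⊕_ × Continuous₂ _⊗_ × IntegersOf.IsoTo M _⊕_ _⊗_
mainTheorem7 em M model countable =
  conjugate _+ᶻ_ , conjugate _*ᶻ_ ,
  continuous₂ {conjugate _+ᶻ_} (conjugate-continuous {_+ᶻ_} +ᶻ-cong-mod) ,
  continuous₂ {conjugate _*ᶻ_} (conjugate-continuous {_*ᶻ_} *ᶻ-cong-mod) ,
  record
    { f = to
    ; injective = λ p q tp≈tq → ∼-all⇒≡ (to-injective λ k → ≈ᶻ⇒≡-mod (modulus k) tp≈tq)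
    ; surjective = λ z → from z , to-from-≈ᶻ z
    ; hom-+ = λ p q → to-from-≈ᶻ (to p +ᶻ to q)
    ; hom-* = λ p q → to-from-≈ᶻ (to p *ᶻ to q)
    }
  where
    open IntegersOf M using (_≈ᶻ_; _+ᶻ_; _*ᶻ_)
    open ModelIntegers.Congruence M (IsModelIΔ₀Exp.paMinus model)
    open ModelIntegers.ModularSpace M (IsModelIΔ₀Exp.paMinus model) countable
    open RationalSpace using (ℚ-space; continuous₂; ∼-all⇒≡)
    open PerfectSpaces.Conjugation em ℚ-space space

    to-from-≈ᶻ : ∀ z → to (from z) ≈ᶻ z
    to-from-≈ᶻ z = ≡-mod-all⇒≈ᶻ (to-from z)
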